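{- Let $\mathcal{C}\subseteq\mathbb{F}^n$ be an $\mathbb{F}$-linear sum-rank metric code, $\rho_{\mathcal{C}}$ the rank function of its associated sum-matroid, and $\rho_{\mathcal{C}}^*(\mathcal{L})=\rho_{\mathcal{C}}(\mathcal{L}^\perp)+\mathrm{Rk}(\mathcal{L})-\rho_{\mathcal{C}}(\mathbf{K}^{\mathbf{n}})$ the rank function of the dual sum-matroid. Then $\rho_{\mathcal{C}}^*(\mathcal{L})=\rho_{\mathcal{C}^\perp}(\mathcal{L})$ for all $\mathcal{L}\in\mathcal{P}(\mathbf{K}^{\mathbf{n}})$.
   Context: Let $\ell,n_1,\dots,n_\ell$ be positive integers, $n=\sum n_i$, $K_1,\dots,K_\ell$ finite fields with a common finite extension $\mathbb{F}$. $\mathbf{K}^{\mathbf{n}}=(K_1^{n_1},\dots,K_\ell^{n_\ell})$; $\mathcal{P}(\mathbf{K}^{\mathbf{n}})$ is the set of tuples $\mathcal{L}=(\mathcal{L}_1,\dots,\mathcal{L}_\ell)$ of $K_i$-subspaces $\mathcal{L}_i\subseteq K_i^{n_i}$, $\mathcal{L}^\perp=(\mathcal{L}_1^\perp,\dots,\mathcal{L}_\ell^\perp)$ with orthogonal complements for the standard dot product, and $\mathrm{Rk}(\mathcal{L})=\sum_i\dim_{K_i}\mathcal{L}_i$. For any $\mathbb{F}$-linear code $\mathcal{D}\subseteq\mathbb{F}^n$ (in particular $\mathcal{D}=\mathcal{C}$ or $\mathcal{C}^\perp$, where $(\mathcal{C}^\perp)^\perp=\mathcal{C}$), and $\mathcal{L}$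 with $\dim_{K_i}\mathcal{L}_i=N_i$, $N=\sum N_i$: let $\mathbf{A}_i\in K_i^{N_i\times n_i}$ have rows forming a basis of $\mathcal{L}_i$, $\mathbf{A}=\mathrm{diag}(\mathbf{A}_1,\dots,\mathbf{A}_\ell)$, $\Pi_{\mathcal{L}}(\mathbf{x})=\mathbf{x}\mathbf{A}^T$ for $\mathbf{x}\in\mathbb{F}^n$, $\mathcal{D}_{\mathcal{L}}=\Pi_{\mathcal{L}}(\mathcal{D}^\perp)$, and $\rho_{\mathcal{D}}(\mathcal{L})=\dim_{\mathbb{F}}\mathcal{D}_{\mathcal{L}}$. -}

module Defs where

open import Level using (Level; _⊔_) renaming (suc to lsuc)
open import Algebra.Bundles using (CommutativeRing)
open import Data.Nat as ℕ using (ℕ)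
open import Data.Fin using (Fin; zero; suc)
open import Data.Product using (Σ; ∃; ∃-syntax; _×_; _,_; proj₁; proj₂)
open import Data.Unit.Polymorphic using (⊤)
open import Relation.Binary.PropositionalEquality using (_≡_)
open import Relation.Nullary using (¬_)

record Field (c ℓ : Level) : Set (lsuc (c ⊔ ℓ)) where
  field
    commutativeRing : CommutativeRing c ℓ
  open CommutativeRing commutativeRing public
  field
    1≉0     : ¬ (1# ≈ 0#)
    inverse : ∀ x → ¬ (x ≈ 0#) → ∃[ y ] (x * y ≈ 1#)

record Finite {c ℓ : Level} (F : Field c ℓ) : Set (c ⊔ ℓ) where
  open Field F using (Carrier; _≈_; _+_; _*_; -_; 0#; 1#)
  field
    size       : ℕ
    enum       : Fin size → Carrier
    index      : Carrier → Fin size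
    enum∘index : ∀ x → enum (index x) ≈ x
    index-cong : ∀ {x y} → x ≈ y → index x ≡ index y

sumℕ : (k : ℕ) → (Fin k → ℕ) → ℕ
sumℕ ℕ.zero f = 0
sumℕ (ℕ.suc k) f = f zero ℕ.+ sumℕ k (λ i → f (suc i))

module _ {c ℓ : Level} (F : Field c ℓ) where
  open Field F using (Carrier; _≈_; _+_; _*_; -_; 0#; 1#)

  -- Subfields K ⊆ F (so F is a common finite extension of the K's)

  record IsSubfield (K : Carrier → Set (c ⊔ ℓ)) : Set (c ⊔ ℓ) where
    field
      K-resp : ∀ {x y} → x ≈ y → K x → K y
      K-0    : K 0#
      K-1    : K 1#
      K-+    : ∀ {x y} → K x → K y → K (x + y)
      K-*    : ∀ {x y} → K x → K y → K (x * y)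
      K-neg  : ∀ {x} → K x → K (- x)
      K-inv  : ∀ {x} → K x → ¬ (x ≈ 0#) → ∃[ y ] (K y × x * y ≈ 1#)

  Full : Carrier → Set (c ⊔ ℓ)
  Full _ = ⊤

  Σ[_] : (m : ℕ) → (Fin m → Carrier) → Carrier
  Σ[ ℕ.zero ] f = 0#
  Σ[ ℕ.suc m ] f = f zero + Σ[ m ] (λ j → f (suc j))

  -- Coordinate index sets: a finite index set is given by a "shape"
  -- Fin ℓ' → ℕ of blocks; coordinates are pairs (block i, position j).

  record Shape : Set where
    constructor shape
    field
      blocks : ℕ
      len    : Fin blocks → ℕ

  Idx : Shape → Set
  Idx (shape b l) = Σ (Fin b) (λ i → Fin (l i))

  ∣_∣ : Shape → ℕ
  ∣ shape b l ∣ = sumℕ b l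

  Vec : Shape → Set c
  Vec s = Idx s → Carrier

  sumIdx : (s : Shape) → (Idx s → Carrier) → Carrier
  sumIdx (shape b l) f = Σ[ b ] (λ i → Σ[ l i ] (λ j → f (i , j)))

  dot : {s : Shape} → Vec s → Vec s → Carrier
  dot {s} x y = sumIdx s (λ k → x k * y k)

  _≋_ : {s : Shape} → Vec s → Vec s → Set ℓ
  x ≋ y = ∀ k → x k ≈ y k

  zeroV : {s : Shape} → Vec s
  zeroV _ = 0#

  lincomb : {d : ℕ} {s : Shape} → (Fin d → Carrier) → (Fin d → Vec s) → Vec s
  lincomb {d} a v k = Σ[ d ] (λ j → a j * v j k)

  record IsBasis (K : Carrier → Set (c ⊔ ℓ)) {s : Shape} (P : Vec s → Set (c ⊔ ℓ))
                 {d : ℕ} (v : Fin d → Vec s) : Set (c ⊔ ℓ) where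
    field
      inP         : ∀ j → P (v j)
      coeffs-in-K : ∀ j k → K (v j k)
      independent : ∀ (a : Fin d → Carrier) → (∀ j → K (a j)) →
                    lincomb a v ≋ zeroV → ∀ j → a j ≈ 0#
      spanning    : ∀ {x} → P x →
                    ∃[ a ] ((∀ j → K (a j)) × lincomb a v ≋ x)

  HasDim : (K : Carrier → Set (c ⊔ ℓ)) {s : Shape} (P : Vec s → Set (c ⊔ ℓ)) (d : ℕ)
           → Set (c ⊔ ℓ)
  HasDim K P d = ∃[ v ] IsBasis K P {d} v

  record IsSubspace (K : Carrier → Set (c ⊔ ℓ)) {s : Shape} (P : Vec s → Set (c ⊔ ℓ))
         : Set (c ⊔ ℓ) where
    field
      P-resp    : ∀ {x y} → x ≋ y → P x → P y
      P-entries : ∀ {x} → P x → ∀ k → K (x k)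
      P-0       : P zeroV
      P-+       : ∀ {x y} → P x → P y → P (λ k → x k + y k)
      P-scale   : ∀ {a x} → K a → P x → P (λ k → a * x k)

  Orth : (K : Carrier → Set (c ⊔ ℓ)) {s : Shape} → (Vec s → Set (c ⊔ ℓ)) → Vec s → Set (c ⊔ ℓ)
  Orth K {s} P x = (∀ k → K (x k)) × (∀ y → P y → dot {s} x y ≈ 0#)

  one : ℕ → Shape
  one m = shape 1 (λ _ → m)

  Tuple : (b : ℕ) (ns : Fin b → ℕ) → Set (lsuc (c ⊔ ℓ))
  Tuple b ns = (i : Fin b) → Vec (one (ns i)) → Set (c ⊔ ℓ)

  InP : (b : ℕ) (ns : Fin b → ℕ) (Ks : Fin b → Carrier → Set (c ⊔ ℓ)) →
        Tuple b ns → Set (c ⊔ ℓ)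
  InP b ns Ks 𝓛 = ∀ i → IsSubspace (Ks i) (𝓛 i)

  -- Π_𝓛(x) = x Aᵀ, A = diag(A_1,…,A_ℓ), rows of A_i given by As i
  Π : {b : ℕ} {ns Ns : Fin b → ℕ} →
      (As : (i : Fin b) → Fin (Ns i) → Vec (one (ns i))) →
      Vec (shape b ns) → Vec (shape b Ns)
  Π {ns = ns} As x (i , j) = Σ[ ns i ] (λ k → x (i , k) * As i j (zero , k))

  Img : {b : ℕ} {ns Ns : Fin b → ℕ} →
        (As : (i : Fin b) → Fin (Ns i) → Vec (one (ns i))) →
        (𝓓 : Vec (shape b ns) → Set (c ⊔ ℓ)) → Vec (shape b Ns) → Set (c ⊔ ℓ)
  Img {b} {ns} As 𝓓 y =
    ∃[ x ] (Orth Full {shape b ns} 𝓓 x × Π As x ≋ y)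

  -- ρ_𝓓(𝓛) = r : for some choice of rows As i forming a K_i-basis of 𝓛_i,
  -- dim_F Π_𝓛(𝓓^⊥) = r  (the paper notes independence of the choice)
  RhoIs : {b : ℕ} {ns : Fin b → ℕ} (Ks : Fin b → Carrier → Set (c ⊔ ℓ))
          (𝓓 : Vec (shape b ns) → Set (c ⊔ ℓ)) (𝓛 : Tuple b ns)
          (r : ℕ) → Set (c ⊔ ℓ)
  RhoIs {b} {ns} Ks 𝓓 𝓛 r =
    ∃[ Ns ] ∃[ As ] ((∀ i → IsBasis (Ks i) (𝓛 i) {Ns i} (As i)) ×
                     HasDim Full (Img {b} {ns} {Ns} As 𝓓) r)

  RkIs : {b : ℕ} {ns : Fin b → ℕ} (Ks : Fin b → Carrier → Set (c ⊔ ℓ))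
         (𝓛 : Tuple b ns) (r : ℕ) → Set (c ⊔ ℓ)
  RkIs {b} Ks 𝓛 r =
    ∃[ Ns ] ((∀ i → HasDim (Ks i) (𝓛 i) (Ns i)) × sumℕ b Ns ≡ r)

  TupleOrth : {b : ℕ} {ns : Fin b → ℕ} (Ks : Fin b → Carrier → Set (c ⊔ ℓ)) →
              Tuple b ns → Tuple b ns
  TupleOrth Ks 𝓛 i = Orth (Ks i) (𝓛 i)

  TupleFull : {b : ℕ} {ns : Fin b → ℕ} (Ks : Fin b → Carrier → Set (c ⊔ ℓ)) →
              Tuple b ns
  TupleFull Ks i x = ∀ k → Ks i (x k)

module Submission where

-- Write D = 𝓒^⊥ ⊆ F^n, let U ⊆ F^n be spanned by the rows of diag(A_1,…,A_ℓ) for bases of the 𝓛_i and W by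
-- those for bases of the 𝓛_i^⊥. Row reduction over K_i shows that K_i-independent vectors stay independent
-- over F, so dim U = Rk(𝓛) and W = U^⊥. With Π_U z = (z · u)_{u ∈ basis of U} we have ρ_𝓒(𝓛^⊥) = dim Π_W(D),
-- ρ_𝓒(K^n) = dim D and ρ_{𝓒^⊥}(𝓛) = dim Π_U(D^⊥). The kernel of Π_U on D^⊥ is (D + U)^⊥, which gives
-- dim Π_U(D^⊥) + dim D = dim (D + U); the kernel of Π_W on D is D ∩ W^⊥ = D ∩ U, which gives
-- dim (D + U) = dim Π_W(D) + dim U. Hence ρ_{𝓒^⊥}(𝓛) + ρ_𝓒(K^n) = ρ_𝓒(𝓛^⊥) + Rk(𝓛).
-- Only 𝓒^⊥ and the given bases enter.

open import Defs
open import Level using (Level; _⊔_)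
import Algebra.Properties.Semiring.Sum as SemiringSum
import Algebra.Properties.Ring as RingProperties
open import Data.Empty using (⊥; ⊥-elim)
open import Data.Fin as Fin using (Fin; zero; suc; punchIn; _↑ˡ_; _↑ʳ_)
import Data.Fin.Properties as Finₚ
open import Data.Nat as ℕ using (ℕ; zero; suc; z≤n; s≤s)
import Data.Nat.Properties as ℕₚ
open import Data.Product as Product using (Σ; ∃-syntax; _×_; _,_; proj₁; proj₂)
open import Data.Sum as Sum using (_⊎_; inj₁; inj₂)
import Data.Sum.Properties as Sumₚ
open import Data.Unit using (⊤; tt)
open import Data.Vec.Functional using (_∷_; _++_; insertAt)
import Data.Vec.Functional.Properties as Vecₚ
open import Function using (_∘_; id)
open import Relation.Binary.Definitions using (Decidable)
open import Relation.Binary.PropositionalEquality as ≡ using (_≡_; _≢_)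
open import Relation.Nullary using (¬_; ¬?; yes; no)
open import Relation.Nullary.Decidable using (decidable-stable; map′)

-- Finiteness of F is used only to decide equality, which drives the search for pivots.
≈-decidable : ∀ {c ℓ} (F : Field c ℓ) → Finite F → Decidable (Field._≈_ F)
≈-decidable F fin x y = map′ (λ eq → trans (sym (enum∘index x)) (trans (reflexive (≡.cong enum eq)) (enum∘index y)))
                             index-cong (index x Fin.≟ index y)
  where
  open Finite fin
  open Field F using (trans; sym; reflexive)

module LinearAlgebra {c ℓ} (F : Field c ℓ) (_≟_ : Decidable (Field._≈_ F)) where

  open Field F hiding (zero)
  open SemiringSum semiring public
    using (sum; sum-cong-≋; sum-cong-≗; sum-replicate-zero; ∑-distrib-+; ∑-comm; sum-remove; *-distribˡ-sum; *-distribʳ-sum)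
  open import Algebra.Properties.AbelianGroup +-abelianGroup using (xyx⁻¹≈y)
  open import Algebra.Properties.Group +-group public using (inverseˡ-unique; x∙y⁻¹≈ε⇒x≈y)
  open RingProperties ring using (x[y-z]≈xy-xz; -‿distribˡ-*; -‿distribʳ-*; -0#≈0#; -‿involutive; -‿+-comm)
  open import Relation.Binary.Reasoning.Setoid setoid

  nonzero-or-allZero : ∀ {m} (v : Fin m → Carrier) → (∃[ q ] ¬ v q ≈ 0#) ⊎ (∀ j → v j ≈ 0#)
  nonzero-or-allZero v with Finₚ.any? (λ j → ¬? (v j ≟ 0#))
  ... | yes nz = inj₁ nz
  ... | no none = inj₂ (λ j → decidable-stable (v j ≟ 0#) (λ nz → none (j , nz)))

  sum-zero : ∀ {m} {f : Fin m → Carrier} → (∀ i → f i ≈ 0#) → sum f ≈ 0#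
  sum-zero {m} f≈0 = trans (sum-cong-≋ f≈0) (sum-replicate-zero m)

  sum-neg : ∀ {m} (f : Fin m → Carrier) → sum (λ i → - f i) ≈ - sum f
  sum-neg {zero} f = sym -0#≈0#
  sum-neg {suc m} f = trans (+-congˡ (sum-neg (f ∘ suc))) (-‿+-comm _ _)

  sum-single : ∀ {m} (q : Fin m) (f : Fin m → Carrier) → (∀ i → i ≢ q → f i ≈ 0#) → sum f ≈ f q
  sum-single {suc m} q f off = begin
    sum f                              ≈⟨ sum-remove {i = q} f ⟩
    f q + sum (f ∘ punchIn q)          ≈⟨ +-congˡ (sum-zero (λ i → off (punchIn q i) (Finₚ.punchInᵢ≢i q i))) ⟩
    f q + 0#                           ≈⟨ +-identityʳ _ ⟩
    f q                                ∎

  sum-++ : ∀ m {n} (f : Fin (m ℕ.+ n) → Carrier) → sum f ≈ sum (λ i → f (i ↑ˡ n)) + sum (λ i → f (m ↑ʳ i))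
  sum-++ zero f = sym (+-identityˡ _)
  sum-++ (suc m) f = trans (+-congˡ (sum-++ m (f ∘ suc))) (sym (+-assoc _ _ _))

  infix 4 _≐_
  _≐_ : {I : Set} → (I → Carrier) → (I → Carrier) → Set ℓ
  u ≐ v = ∀ k → u k ≈ v k

  0v : {I : Set} → I → Carrier
  0v _ = 0#

  linComb : ∀ {m} {I : Set} → (Fin m → Carrier) → (Fin m → I → Carrier) → I → Carrier
  linComb a V k = sum (λ j → a j * V j k)

  unit : ∀ {m} → Fin m → Fin m → Carrier
  unit j i with j Fin.≟ i
  ... | yes _ = 1#
  ... | no _ = 0#

  unit-diag : ∀ {m} (j : Fin m) → unit j j ≈ 1#
  unit-diag j with j Fin.≟ j
  ... | yes _ = refl
  ... | no j≢j = ⊥-elim (j≢j ≡.refl)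

  unit-off : ∀ {m} {j i : Fin m} → j ≢ i → unit j i ≈ 0#
  unit-off {j = j} {i} j≢i with j Fin.≟ i
  ... | yes j≡i = ⊥-elim (j≢i j≡i)
  ... | no _ = refl

  module _ {I : Set} where

    linComb-cong : ∀ {m} {a a' : Fin m → Carrier} {V V' : Fin m → I → Carrier} →
                   a ≐ a' → (∀ j → V j ≐ V' j) → linComb a V ≐ linComb a' V'
    linComb-cong a≐a' V≐V' k = sum-cong-≋ (λ j → *-cong (a≐a' j) (V≐V' j k))

    linComb-congˡ : ∀ {m} {a a' : Fin m → Carrier} (V : Fin m → I → Carrier) → a ≐ a' → linComb a V ≐ linComb a' V
    linComb-congˡ V a≐a' = linComb-cong a≐a' (λ _ _ → refl)

    linComb-congʳ : ∀ {m} (a : Fin m → Carrier) {V V' : Fin m → I → Carrier} →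
                    (∀ j → V j ≐ V' j) → linComb a V ≐ linComb a V'
    linComb-congʳ a V≐V' = linComb-cong (λ _ → refl) V≐V'

    linComb-+ : ∀ {m} (a b : Fin m → Carrier) (V : Fin m → I → Carrier) →
                linComb (λ j → a j + b j) V ≐ (λ k → linComb a V k + linComb b V k)
    linComb-+ a b V k = trans (sum-cong-≋ (λ j → distribʳ (V j k) (a j) (b j)))
                              (∑-distrib-+ (λ j → a j * V j k) (λ j → b j * V j k))

    linComb-* : ∀ {m} (t : Carrier) (a : Fin m → Carrier) (V : Fin m → I → Carrier) →
                linComb (λ j → t * a j) V ≐ (λ k → t * linComb a V k)
    linComb-* t a V k = trans (sum-cong-≋ (λ j → *-assoc t (a j) (V j k))) (sym (*-distribˡ-sum t (λ j → a j * V j k)))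

    linComb-neg : ∀ {m} (a : Fin m → Carrier) (V : Fin m → I → Carrier) →
                  linComb (λ j → - a j) V ≐ (λ k → - linComb a V k)
    linComb-neg a V k = trans (sum-cong-≋ (λ j → sym (-‿distribˡ-* (a j) (V j k)))) (sum-neg (λ j → a j * V j k))

    linComb-zeroˡ : ∀ {m} {a : Fin m → Carrier} (V : Fin m → I → Carrier) → a ≐ 0v → linComb a V ≐ 0v
    linComb-zeroˡ V a≈0 k = sum-zero (λ j → trans (*-congʳ (a≈0 j)) (zeroˡ _))

    linComb-zeroʳ : ∀ {m} (a : Fin m → Carrier) (V : Fin m → I → Carrier) (k : I) →
                    (∀ j → V j k ≈ 0#) → linComb a V k ≈ 0#
    linComb-zeroʳ a V k V≈0 = sum-zero (λ j → trans (*-congˡ (V≈0 j)) (zeroʳ _))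

    linComb-assoc : ∀ {n m} (a : Fin n → Carrier) (B : Fin n → Fin m → Carrier) (V : Fin m → I → Carrier) →
                    linComb (linComb a B) V ≐ linComb a (λ i → linComb (B i) V)
    linComb-assoc {n} {m} a B V k = begin
      sum (λ l → sum (λ i → a i * B i l) * V l k)    ≈⟨ sum-cong-≋ (λ l → *-distribʳ-sum (V l k) (λ i → a i * B i l)) ⟩
      sum (λ l → sum (λ i → (a i * B i l) * V l k))  ≈⟨ ∑-comm (λ i l → (a i * B i l) * V l k) ⟨
      sum (λ i → sum (λ l → (a i * B i l) * V l k))  ≈⟨ sum-cong-≋ (λ i → sum-cong-≋ (λ l → *-assoc (a i) (B i l) (V l k))) ⟩
      sum (λ i → sum (λ l → a i * (B i l * V l k)))  ≈⟨ sum-cong-≋ (λ i → *-distribˡ-sum (a i) (λ l → B i l * V l k)) ⟨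
      sum (λ i → a i * linComb (B i) V k)             ∎

    linComb-++ : ∀ d {ν} (a : Fin (d ℕ.+ ν) → Carrier) (E : Fin d → I → Carrier) (G : Fin ν → I → Carrier) →
                 linComb a (E ++ G) ≐ (λ k → linComb (λ i → a (i ↑ˡ ν)) E k + linComb (λ i → a (d ↑ʳ i)) G k)
    linComb-++ d {ν} a E G k = trans (sum-++ d _) (+-cong
      (sum-cong-≋ (λ i → *-congˡ (reflexive (≡.cong (λ v → v k) (Vecₚ.lookup-++ˡ E G i)))))
      (sum-cong-≋ (λ i → *-congˡ (reflexive (≡.cong (λ v → v k) (Vecₚ.lookup-++ʳ E G i))))))

    linComb-sub : ∀ {m} (a b : Fin m → Carrier) (V : Fin m → I → Carrier) →
                  linComb (λ j → a j - b j) V ≐ (λ k → linComb a V k - linComb b V k)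
    linComb-sub a b V k = trans (linComb-+ a (λ j → - b j) V k) (+-congˡ (linComb-neg b V k))

    linComb-++-++ : ∀ d {ν} (a : Fin d → Carrier) (b : Fin ν → Carrier) (E : Fin d → I → Carrier) (G : Fin ν → I → Carrier) →
                    linComb (a ++ b) (E ++ G) ≐ (λ k → linComb a E k + linComb b G k)
    linComb-++-++ d a b E G k = trans (linComb-++ d (a ++ b) E G k) (+-cong
      (linComb-congˡ E (λ i → reflexive (Vecₚ.lookup-++ˡ a b i)) k)
      (linComb-congˡ G (λ i → reflexive (Vecₚ.lookup-++ʳ a b i)) k))

    linComb-insertAt : ∀ {m} (a : Fin m → Carrier) (q : Fin (suc m)) (x : Carrier) (V : Fin (suc m) → I → Carrier) →
                       linComb (insertAt a q x) V ≐ (λ k → x * V q k + linComb a (V ∘ punchIn q) k)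
    linComb-insertAt a q x V k = trans (sum-remove {i = q} (λ j → insertAt a q x j * V j k)) (+-cong
      (*-congʳ (reflexive (Vecₚ.insertAt-lookup a q x)))
      (sum-cong-≋ (λ i → *-congʳ (reflexive (Vecₚ.insertAt-punchIn a q x i)))))

    linComb-unitˡ : ∀ {m} (V : Fin m → I → Carrier) (j : Fin m) → linComb (unit j) V ≐ V j
    linComb-unitˡ V j k = trans (sum-single j _ (λ i i≢j → trans (*-congʳ (unit-off (i≢j ∘ ≡.sym))) (zeroˡ _)))
                                (trans (*-congʳ (unit-diag j)) (*-identityˡ _))

  linComb-unitʳ : ∀ {m} (a : Fin m → Carrier) → linComb a unit ≐ a
  linComb-unitʳ a i = trans (sum-single i _ (λ j j≢i → trans (*-congˡ (unit-off j≢i)) (zeroʳ _)))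
                            (trans (*-congˡ (unit-diag i)) (*-identityʳ _))

  -- Gaussian elimination

  module Elimination {I : Set} (k₀ : I) (p : I → Carrier) {γ : Carrier} (pγ≈1 : p k₀ * γ ≈ 1#) where

    factor : (I → Carrier) → Carrier
    factor v = v k₀ * γ

    eliminate : (I → Carrier) → I → Carrier
    eliminate v k = v k - factor v * p k

    eliminate-pivot : ∀ v → eliminate v k₀ ≈ 0#
    eliminate-pivot v = begin
      v k₀ - (v k₀ * γ) * p k₀ ≈⟨ +-congˡ (-‿cong (trans (*-assoc _ _ _) (*-congˡ (trans (*-comm γ _) pγ≈1)))) ⟩
      v k₀ - v k₀ * 1#         ≈⟨ +-congˡ (-‿cong (*-identityʳ _)) ⟩
      v k₀ - v k₀              ≈⟨ -‿inverseʳ _ ⟩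
      0#                       ∎

    eliminate-restore : ∀ v → (λ k → factor v * p k + eliminate v k) ≐ v
    eliminate-restore v k = trans (sym (+-assoc _ _ _)) (xyx⁻¹≈y _ _)

    linComb-eliminate : ∀ {m} (a : Fin m → Carrier) (W : Fin m → I → Carrier) →
                        linComb a (eliminate ∘ W) ≐
                        (λ k → - sum (λ i → a i * factor (W i)) * p k + linComb a W k)
    linComb-eliminate a W k = begin
      sum (λ i → a i * eliminate (W i) k)                          ≈⟨ sum-cong-≋ (λ i → distribute (a i) (W i k) (factor (W i)) (p k)) ⟩
      sum (λ i → - (a i * factor (W i)) * p k + a i * W i k)       ≈⟨ ∑-distrib-+ (λ i → - (a i * factor (W i)) * p k) (λ i → a i * W i k) ⟩
      sum (λ i → - (a i * factor (W i)) * p k) + linComb a W k     ≈⟨ +-congʳ (*-distribʳ-sum (p k) (λ i → - (a i * factor (W i)))) ⟨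
      sum (λ i → - (a i * factor (W i))) * p k + linComb a W k     ≈⟨ +-congʳ (*-congʳ (sum-neg (λ i → a i * factor (W i)))) ⟩
      - sum (λ i → a i * factor (W i)) * p k + linComb a W k       ∎
      where
      distribute : ∀ a w t x → a * (w - t * x) ≈ - (a * t) * x + a * w
      distribute a w t x = begin
        a * (w - t * x)         ≈⟨ x[y-z]≈xy-xz a w (t * x) ⟩
        a * w - a * (t * x)     ≈⟨ +-comm _ _ ⟩
        - (a * (t * x)) + a * w ≈⟨ +-congʳ (-‿cong (*-assoc a t x)) ⟨
        - (a * t * x) + a * w   ≈⟨ +-congʳ (-‿distribˡ-* (a * t) x) ⟩
        - (a * t) * x + a * w   ∎

  cancel-invertible : ∀ {x y γ} → y * γ ≈ 1# → x * y ≈ 0# → x ≈ 0#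
  cancel-invertible {x} {y} {γ} yγ≈1 xy≈0 = begin
    x             ≈⟨ *-identityʳ x ⟨
    x * 1#        ≈⟨ *-congˡ yγ≈1 ⟨
    x * (y * γ)   ≈⟨ *-assoc x y γ ⟨
    (x * y) * γ   ≈⟨ *-congʳ xy≈0 ⟩
    0# * γ        ≈⟨ zeroˡ γ ⟩
    0#            ∎

  solve-linear : ∀ {x r e ρ} → r * ρ ≈ 1# → x + r * e ≈ 0# → - ρ * x ≈ e
  solve-linear {x} {r} {e} {ρ} rρ≈1 x+re≈0 = begin
    - ρ * x              ≈⟨ *-congˡ (inverseˡ-unique x (r * e) x+re≈0) ⟩
    - ρ * - (r * e)      ≈⟨ -‿distribˡ-* ρ _ ⟨
    - (ρ * - (r * e))    ≈⟨ -‿cong (-‿distribʳ-* ρ (r * e)) ⟨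
    - - (ρ * (r * e))    ≈⟨ -‿involutive _ ⟩
    ρ * (r * e)          ≈⟨ *-assoc ρ r e ⟨
    (ρ * r) * e          ≈⟨ *-congʳ (trans (*-comm ρ r) rρ≈1) ⟩
    1# * e               ≈⟨ *-identityˡ e ⟩
    e                    ∎

  ++-cons : ∀ {A : Set c} {r m} (x : A) (E : Fin r → A) (G : Fin m → A) (l : Fin (r ℕ.+ m)) →
            ((x ∷ E) ++ G) (suc l) ≡ (E ++ G) l
  ++-cons {r = r} x E G l = Sumₚ.[,]-map (Fin.splitAt r l)

  ∘-++ : ∀ {A B : Set c} {r m} (f : A → B) (E : Fin r → A) (G : Fin m → A) (l : Fin (r ℕ.+ m)) →
         ((f ∘ E) ++ (f ∘ G)) l ≡ f ((E ++ G) l)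
  ∘-++ {r = r} f E G l = ≡.sym (Sumₚ.[,]-∘ f (Fin.splitAt r l))

  ++-all : ∀ {A : Set c} {p} (P : A → Set p) {d ν} {xs : Fin d → A} {ys : Fin ν → A} →
           (∀ i → P (xs i)) → (∀ i → P (ys i)) → ∀ l → P ((xs ++ ys) l)
  ++-all P {d} Pxs Pys l with Fin.splitAt d l
  ... | inj₁ i = Pxs i
  ... | inj₂ i = Pys i

  ++-≐0 : ∀ d {ν} (a : Fin (d ℕ.+ ν) → Carrier) → (λ i → a (i ↑ˡ ν)) ≐ 0v → (λ i → a (d ↑ʳ i)) ≐ 0v → a ≐ 0v
  ++-≐0 d a left≐0 right≐0 l with Fin.splitAt d l in eq
  ... | inj₁ i = trans (reflexive (≡.cong a (≡.sym (Finₚ.splitAt⁻¹-↑ˡ eq)))) (left≐0 i)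
  ... | inj₂ i = trans (reflexive (≡.cong a (≡.sym (Finₚ.splitAt⁻¹-↑ʳ eq)))) (right≐0 i)

  transpose : ∀ {m N} → (Fin m → Fin N → Carrier) → Fin N → Fin m → Carrier
  transpose V k t = V t k

  -- Coordinates Fin N ⊎ Y, of which only the first N take part in the elimination.
  module _ {Y : Set} where

    behead : ∀ {N} → (Fin (suc N) ⊎ Y → Carrier) → Fin N ⊎ Y → Carrier
    behead v = v ∘ Sum.map₁ suc

    prepend0 : ∀ {N} → (Fin N ⊎ Y → Carrier) → Fin (suc N) ⊎ Y → Carrier
    prepend0 v (inj₁ zero) = 0#
    prepend0 v (inj₁ (suc k)) = v (inj₁ k)
    prepend0 v (inj₂ y) = v (inj₂ y)

    prepend0-behead : ∀ {N} (v : Fin (suc N) ⊎ Y → Carrier) → v (inj₁ zero) ≈ 0# → prepend0 (behead v) ≐ v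
    prepend0-behead v v₀≈0 (inj₁ zero) = sym v₀≈0
    prepend0-behead v v₀≈0 (inj₁ (suc k)) = refl
    prepend0-behead v v₀≈0 (inj₂ y) = refl

    prepend0-cong : ∀ {N} {u v : Fin N ⊎ Y → Carrier} → u ≐ v → prepend0 u ≐ prepend0 v
    prepend0-cong u≐v (inj₁ zero) = refl
    prepend0-cong u≐v (inj₁ (suc k)) = u≐v (inj₁ k)
    prepend0-cong u≐v (inj₂ y) = u≐v (inj₂ y)

    linComb-prepend0 : ∀ {N m} (a : Fin m → Carrier) (V : Fin m → Fin N ⊎ Y → Carrier) →
                       linComb a (prepend0 ∘ V) ≐ prepend0 (linComb a V)
    linComb-prepend0 a V (inj₁ zero) = linComb-zeroʳ a (prepend0 ∘ V) (inj₁ zero) (λ _ → refl)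
    linComb-prepend0 a V (inj₁ (suc k)) = refl
    linComb-prepend0 a V (inj₂ y) = refl

  Within : {I : Set} → (Carrier → Set (c ⊔ ℓ)) → (I → Carrier) → Set (c ⊔ ℓ)
  Within S v = ∀ k → S (v k)

  record InSpan {m} {I : Set} (S : Carrier → Set (c ⊔ ℓ)) (V : Fin m → I → Carrier) (x : I → Carrier) : Set (c ⊔ ℓ) where
    constructor inSpan
    field
      coeffs   : Fin m → Carrier
      coeffs-S : Within S coeffs
      combines : linComb coeffs V ≐ x

  Independent : ∀ {m} {I : Set} → (Carrier → Set (c ⊔ ℓ)) → (Fin m → I → Carrier) → Set (c ⊔ ℓ)
  Independent S V = ∀ a → Within S a → linComb a V ≐ 0v → a ≐ 0v

  InSpan-map : ∀ {S T : Carrier → Set (c ⊔ ℓ)} {m} {I : Set} {V : Fin m → I → Carrier} {x} →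
               (∀ {t} → S t → T t) → InSpan S V x → InSpan T V x
  InSpan-map S⊆T (inSpan a aS a·V≐x) = inSpan a (S⊆T ∘ aS) a·V≐x

  Full-isSubfield : IsSubfield F (Full F)
  Full-isSubfield = record
    { K-resp = _ ; K-0 = _ ; K-1 = _ ; K-+ = _ ; K-* = _ ; K-neg = _
    ; K-inv = λ {x} _ x≉0 → let (y , xy≈1) = inverse x x≉0 in y , _ , xy≈1 }

  module Spans (S : Carrier → Set (c ⊔ ℓ)) (isS : IsSubfield F S) where
    open IsSubfield isS

    S-sum : ∀ {m} {f : Fin m → Carrier} → Within S f → S (sum f)
    S-sum {zero} _ = K-0
    S-sum {suc m} fS = K-+ (fS zero) (S-sum (fS ∘ suc))

    S-linComb : ∀ {m} {I : Set} {a : Fin m → Carrier} {V : Fin m → I → Carrier} →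
                Within S a → (∀ j → Within S (V j)) → Within S (linComb a V)
    S-linComb aS VS k = S-sum (λ j → K-* (aS j) (VS j k))

    S-unit : ∀ {m} (j : Fin m) → Within S (unit j)
    S-unit j i with j Fin.≟ i
    ... | yes _ = K-1
    ... | no _ = K-0

    span-resp : ∀ {m} {I : Set} {E : Fin m → I → Carrier} {x y : I → Carrier} → x ≐ y → InSpan S E x → InSpan S E y
    span-resp x≐y (inSpan a aS a·E≐x) = inSpan a aS λ k → trans (a·E≐x k) (x≐y k)

    span-+ : ∀ {m} {I : Set} {E : Fin m → I → Carrier} {x y : I → Carrier} →
             InSpan S E x → InSpan S E y → InSpan S E (λ k → x k + y k)
    span-+ {E = E} (inSpan a aS a·E≐x) (inSpan b bS b·E≐y) =
      inSpan (λ j → a j + b j) (λ j → K-+ (aS j) (bS j)) λ k → trans (linComb-+ a b E k) (+-cong (a·E≐x k) (b·E≐y k))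

    span-* : ∀ {m} {I : Set} {E : Fin m → I → Carrier} {x : I → Carrier} {t : Carrier} → S t →
             InSpan S E x → InSpan S E (λ k → t * x k)
    span-* {E = E} {t = t} tS (inSpan a aS a·E≐x) =
      inSpan (λ j → t * a j) (λ j → K-* tS (aS j)) λ k → trans (linComb-* t a E k) (*-congˡ (a·E≐x k))

    span-generator : ∀ {m} {I : Set} (E : Fin m → I → Carrier) (j : Fin m) → InSpan S E (E j)
    span-generator E j = inSpan (unit j) (S-unit j) (linComb-unitˡ E j)

    span-trans : ∀ {m p} {I : Set} {V : Fin m → I → Carrier} {E : Fin p → I → Carrier} {x : I → Carrier} →
                 (∀ j → InSpan S E (V j)) → InSpan S V x → InSpan S E x
    span-trans {m} {p} {V = V} {E} {x} V⊆E (inSpan a aS a·V≐x) =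
      inSpan (linComb a B) (S-linComb aS (λ j → InSpan.coeffs-S (V⊆E j))) λ k → begin
        linComb (linComb a B) E k                 ≈⟨ linComb-assoc a B E k ⟩
        linComb a (λ j → linComb (B j) E) k       ≈⟨ linComb-congʳ a (λ j → InSpan.combines (V⊆E j)) k ⟩
        linComb a V k                             ≈⟨ a·V≐x k ⟩
        x k                                       ∎
      where
      B : Fin m → Fin p → Carrier
      B j = InSpan.coeffs (V⊆E j)

  module OverSubfield (S : Carrier → Set (c ⊔ ℓ)) (isS : IsSubfield F S) where
    open IsSubfield isS
    open Spans S isS public

    S-insertAt : ∀ {m} {a : Fin m → Carrier} {x : Carrier} (q : Fin (suc m)) → Within S a → S x → Within S (insertAt a q x)
    S-insertAt zero aS xS zero = xS
    S-insertAt zero aS xS (suc j) = aS j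
    S-insertAt {suc m} (suc q) aS xS zero = aS zero
    S-insertAt {suc m} (suc q) aS xS (suc j) = S-insertAt q (aS ∘ suc) xS j

    module Pivot {I : Set} (k₀ : I) {m} (A : Fin (suc m) → I → Carrier) (AS : ∀ j → Within S (A j))
                 (q : Fin (suc m)) (A[q]≉0 : ¬ A q k₀ ≈ 0#) where

      private
        inv : ∃[ γ ] (S γ × A q k₀ * γ ≈ 1#)
        inv = K-inv (AS q k₀) A[q]≉0

      open Elimination k₀ (A q) (proj₂ (proj₂ inv)) public

      pivot-inverse : A q k₀ * proj₁ inv ≈ 1#
      pivot-inverse = proj₂ (proj₂ inv)

      factor-S : ∀ j → S (factor (A j))
      factor-S j = K-* (AS j k₀) (proj₁ (proj₂ inv))

      eliminate-S : ∀ j → Within S (eliminate (A j))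
      eliminate-S j k = K-+ (AS j k) (K-neg (K-* (factor-S j) (AS q k)))

      eliminate-inSpan : ∀ j → InSpan S A (eliminate (A j))
      eliminate-inSpan j = span-resp (λ k → +-congˡ (sym (-‿distribˡ-* (factor (A j)) (A q k))))
        (span-+ (span-generator A j) (span-* (K-neg (factor-S j)) (span-generator A q)))

      eliminate-independent : Independent S A → Independent S (λ i → eliminate (A (punchIn q i)))
      eliminate-independent ind a aS a·elim≐0 i = begin
        a i                            ≡⟨ Vecₚ.insertAt-punchIn a q x i ⟨
        insertAt a q x (punchIn q i)   ≈⟨ ind (insertAt a q x) (S-insertAt q aS xS) b·A≐0 (punchIn q i) ⟩
        0#                             ∎
        where
        x : Carrier
        x = - sum (λ i → a i * factor (A (punchIn q i)))
        xS : S x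
        xS = K-neg (S-sum (λ i → K-* (aS i) (factor-S (punchIn q i))))
        b·A≐0 : linComb (insertAt a q x) A ≐ 0v
        b·A≐0 k = begin
          linComb (insertAt a q x) A k                     ≈⟨ linComb-insertAt a q x A k ⟩
          x * A q k + linComb a (A ∘ punchIn q) k          ≈⟨ linComb-eliminate a (A ∘ punchIn q) k ⟨
          linComb a (λ i → eliminate (A (punchIn q i))) k  ≈⟨ a·elim≐0 k ⟩
          0#                                               ∎

    independent-tail : ∀ {m p} (A : Fin m → Fin (suc p) → Carrier) → (∀ j → A j zero ≈ 0#) →
                       Independent S A → Independent S (λ j → A j ∘ suc)
    independent-tail A heads≈0 ind a aS a·tails≐0 = ind a aS λ
      { zero → linComb-zeroʳ a A zero heads≈0 ; (suc k) → a·tails≐0 k }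

    independent⇒length≤ : ∀ p {m} (A : Fin m → Fin p → Carrier) → (∀ j → Within S (A j)) → Independent S A → m ℕ.≤ p
    independent⇒length≤ zero {zero} _ _ _ = z≤n
    independent⇒length≤ zero {suc m} A _ ind =
      ⊥-elim (1≉0 (trans (sym (unit-diag {suc m} zero)) (ind (unit {suc m} zero) (S-unit zero) (λ ()) zero)))
    independent⇒length≤ (suc p) {zero} _ _ _ = z≤n
    independent⇒length≤ (suc p) {suc m} A AS ind with nonzero-or-allZero (λ j → A j zero)
    ... | inj₂ heads≈0 = ℕₚ.m≤n⇒m≤1+n
      (independent⇒length≤ p _ (λ j → AS j ∘ suc) (independent-tail A heads≈0 ind))
    ... | inj₁ (q , A[q]≉0) = s≤s (independent⇒length≤ p _ (λ i → P.eliminate-S (punchIn q i) ∘ suc)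
      (independent-tail _ (λ i → P.eliminate-pivot (A (punchIn q i))) (P.eliminate-independent ind)))
      where module P = Pivot zero A AS q A[q]≉0

    steinitz : ∀ {I : Set} {p m} (E : Fin p → I → Carrier) (U : Fin m → I → Carrier) →
               Independent S U → (∀ i → InSpan S E (U i)) → m ℕ.≤ p
    steinitz {p = p} {m} E U ind U⊆E = independent⇒length≤ p A (λ i → InSpan.coeffs-S (U⊆E i)) A-independent
      where
      A : Fin m → Fin p → Carrier
      A i = InSpan.coeffs (U⊆E i)
      A-independent : Independent S A
      A-independent a aS a·A≐0 = ind a aS λ k → begin
        linComb a U k                            ≈⟨ linComb-congʳ a (λ i → InSpan.combines (U⊆E i)) k ⟨
        linComb a (λ i → linComb (A i) E) k      ≈⟨ linComb-assoc a A E k ⟨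
        linComb (linComb a A) E k                ≈⟨ linComb-zeroˡ E a·A≐0 k ⟩
        0#                                       ∎

    dim-unique : ∀ {I : Set} {d d'} {E : Fin d → I → Carrier} {E' : Fin d' → I → Carrier} →
                 Independent S E → Independent S E' → (∀ i → InSpan S E' (E i)) → (∀ i → InSpan S E (E' i)) → d ≡ d'
    dim-unique {E = E} {E'} ind ind' E⊆E' E'⊆E = ℕₚ.≤-antisym (steinitz E' E ind E⊆E') (steinitz E E' ind' E'⊆E)

    module _ {Y : Set} where

      S-prepend0 : ∀ {N} {v : Fin N ⊎ Y → Carrier} → Within S v → Within S (prepend0 v)
      S-prepend0 vS (inj₁ zero) = K-0
      S-prepend0 vS (inj₁ (suc k)) = vS (inj₁ k)
      S-prepend0 vS (inj₂ y) = vS (inj₂ y)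

      span-prepend0 : ∀ {N m} {V : Fin m → Fin (suc N) ⊎ Y → Carrier} → (∀ j → V j (inj₁ zero) ≈ 0#) →
                      ∀ {x} → InSpan S (behead ∘ V) x → InSpan S V (prepend0 x)
      span-prepend0 {V = V} heads≈0 {x} (inSpan a aS a·V≐x) = inSpan a aS λ k → begin
        linComb a V k                             ≈⟨ linComb-congʳ a (λ j → prepend0-behead (V j) (heads≈0 j)) k ⟨
        linComb a (prepend0 ∘ behead ∘ V) k       ≈⟨ linComb-prepend0 a (behead ∘ V) k ⟩
        prepend0 (linComb a (behead ∘ V)) k       ≈⟨ prepend0-cong a·V≐x k ⟩
        prepend0 x k                              ∎

      record Echelon (N : ℕ) {m : ℕ} (V : Fin m → Fin N ⊎ Y → Carrier) : Set (c ⊔ ℓ) where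
        field
          rank               : ℕ
          pivots             : Fin rank → Fin N ⊎ Y → Carrier
          #rest              : ℕ
          rest               : Fin #rest → Fin N ⊎ Y → Carrier
          pivots-S           : ∀ i → Within S (pivots i)
          rest-S             : ∀ i → Within S (rest i)
          pivots-inSpan      : ∀ i → InSpan S V (pivots i)
          rest-inSpan        : ∀ i → InSpan S V (rest i)
          rest-vanishes      : ∀ i k → rest i (inj₁ k) ≈ 0#
          generates          : ∀ j → InSpan S (pivots ++ rest) (V j)
          pivots-independent : ∀ a → (∀ k → linComb a pivots (inj₁ k) ≈ 0#) → a ≐ 0v

      echelon-trivial : ∀ {m} (V : Fin m → Fin 0 ⊎ Y → Carrier) → (∀ j → Within S (V j)) → Echelon 0 V
      echelon-trivial {m} V VS = record
        { rank = 0 ; pivots = λ () ; #rest = m ; rest = V ; pivots-S = λ () ; rest-S = VS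
        ; pivots-inSpan = λ () ; rest-inSpan = span-generator V ; rest-vanishes = λ _ ()
        ; generates = span-generator V ; pivots-independent = λ _ _ () }

      echelon-lift : ∀ {N m} (V : Fin m → Fin (suc N) ⊎ Y → Carrier) → (∀ j → V j (inj₁ zero) ≈ 0#) →
                     Echelon N (behead ∘ V) → Echelon (suc N) V
      echelon-lift V heads≈0 E = record
        { rank = rank ; pivots = prepend0 ∘ pivots ; #rest = #rest ; rest = prepend0 ∘ rest
        ; pivots-S = S-prepend0 ∘ pivots-S ; rest-S = S-prepend0 ∘ rest-S
        ; pivots-inSpan = span-prepend0 heads≈0 ∘ pivots-inSpan
        ; rest-inSpan = span-prepend0 heads≈0 ∘ rest-inSpan
        ; rest-vanishes = λ { i zero → refl ; i (suc k) → rest-vanishes i k }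
        ; generates = λ j → lifted j (generates j)
        ; pivots-independent = λ a a·pivots≈0 → pivots-independent a (a·pivots≈0 ∘ suc) }
        where
        open Echelon E
        lifted : ∀ j → InSpan S (pivots ++ rest) (behead (V j)) → InSpan S ((prepend0 ∘ pivots) ++ (prepend0 ∘ rest)) (V j)
        lifted j (inSpan a aS a·G≐Vj) = inSpan a aS λ k → begin
          linComb a ((prepend0 ∘ pivots) ++ (prepend0 ∘ rest)) k
            ≈⟨ linComb-congʳ a (λ l → reflexive ∘ ≡.cong-app (∘-++ prepend0 pivots rest l)) k ⟩
          linComb a (prepend0 ∘ (pivots ++ rest)) k    ≈⟨ linComb-prepend0 a (pivots ++ rest) k ⟩
          prepend0 (linComb a (pivots ++ rest)) k      ≈⟨ prepend0-cong a·G≐Vj k ⟩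
          prepend0 (behead (V j)) k                    ≈⟨ prepend0-behead (V j) (heads≈0 j) k ⟩
          V j k                                        ∎

      module PivotStep {N m} (V : Fin (suc m) → Fin (suc N) ⊎ Y → Carrier) (VS : ∀ j → Within S (V j))
                       (q : Fin (suc m)) (V[q]≉0 : ¬ V q (inj₁ zero) ≈ 0#) where
        open Pivot (inj₁ zero) V VS q V[q]≉0 public

        module _ (E : Echelon (suc N) (eliminate ∘ V)) where
          open Echelon E

          extended : Fin (suc rank ℕ.+ #rest) → Fin (suc N) ⊎ Y → Carrier
          extended = (V q ∷ pivots) ++ rest

          extended-⊇ : ∀ l → InSpan S extended ((pivots ++ rest) l)
          extended-⊇ l = ≡.subst (InSpan S extended) (++-cons (V q) pivots rest l) (span-generator extended (suc l))

          pivots-head : ∀ i → pivots i (inj₁ zero) ≈ 0#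
          pivots-head i = let inSpan b _ b·W≐p = pivots-inSpan i in
            trans (sym (b·W≐p (inj₁ zero))) (linComb-zeroʳ b (eliminate ∘ V) (inj₁ zero) (λ j → eliminate-pivot (V j)))

          extended-independent : ∀ a → (∀ k → linComb a (V q ∷ pivots) (inj₁ k) ≈ 0#) → a ≐ 0v
          extended-independent a a·P≈0 = λ { zero → a₀≈0 ; (suc i) → pivots-independent (a ∘ suc) tail≈0 i }
            where
            a₀≈0 : a zero ≈ 0#
            a₀≈0 = cancel-invertible pivot-inverse (begin
              a zero * V q (inj₁ zero)                  ≈⟨ +-identityʳ _ ⟨
              a zero * V q (inj₁ zero) + 0#             ≈⟨ +-congˡ (linComb-zeroʳ (a ∘ suc) pivots (inj₁ zero) pivots-head) ⟨
              linComb a (V q ∷ pivots) (inj₁ zero)      ≈⟨ a·P≈0 zero ⟩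
              0#                                        ∎)
            tail≈0 : ∀ k → linComb (a ∘ suc) pivots (inj₁ k) ≈ 0#
            tail≈0 k = begin
              linComb (a ∘ suc) pivots (inj₁ k)                          ≈⟨ +-identityˡ _ ⟨
              0# + linComb (a ∘ suc) pivots (inj₁ k)                     ≈⟨ +-congʳ (trans (*-congʳ a₀≈0) (zeroˡ _)) ⟨
              a zero * V q (inj₁ k) + linComb (a ∘ suc) pivots (inj₁ k)  ≈⟨ a·P≈0 k ⟩
              0#                                                         ∎

          echelon-pivot : Echelon (suc N) V
          echelon-pivot = record
            { rank = suc rank ; pivots = V q ∷ pivots ; #rest = #rest ; rest = rest
            ; pivots-S = λ { zero → VS q ; (suc i) → pivots-S i } ; rest-S = rest-S
            ; pivots-inSpan = λ { zero → span-generator V q ; (suc i) → span-trans eliminate-inSpan (pivots-inSpan i) }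
            ; rest-inSpan = span-trans eliminate-inSpan ∘ rest-inSpan
            ; rest-vanishes = rest-vanishes
            ; generates = λ j → span-resp (eliminate-restore (V j))
                (span-+ (span-* (factor-S j) (span-generator extended zero)) (span-trans extended-⊇ (generates j)))
            ; pivots-independent = extended-independent }

      echelon : ∀ N {m} (V : Fin m → Fin N ⊎ Y → Carrier) → (∀ j → Within S (V j)) → Echelon N V
      echelon zero V VS = echelon-trivial V VS
      echelon (suc N) {zero} V VS = echelon-lift V (λ ()) (echelon N (behead ∘ V) (λ ()))
      echelon (suc N) {suc m} V VS with nonzero-or-allZero (λ j → V j (inj₁ zero))
      ... | inj₂ heads≈0 = echelon-lift V heads≈0 (echelon N (behead ∘ V) (λ j → VS j ∘ Sum.map₁ suc))
      ... | inj₁ (q , V[q]≉0) = echelon-pivot (echelon-lift (eliminate ∘ V) (eliminate-pivot ∘ V)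
              (echelon N (behead ∘ eliminate ∘ V) (λ j → eliminate-S j ∘ Sum.map₁ suc)))
        where open PivotStep V VS q V[q]≉0

    -- Bases and rank–nullity

    record SpanBasis {I : Set} {m} (V : Fin m → I → Carrier) : Set (c ⊔ ℓ) where
      field
        dim               : ℕ
        basis             : Fin dim → I → Carrier
        basis-S           : ∀ i → Within S (basis i)
        basis-independent : Independent S basis
        basis-inSpan      : ∀ i → InSpan S V (basis i)
        spans             : ∀ j → InSpan S basis (V j)

    independent-spanBasis : ∀ {I : Set} {m} (V : Fin m → I → Carrier) →
                            (∀ j → Within S (V j)) → Independent S V → SpanBasis V
    independent-spanBasis {m = m} V VS ind = record
      { dim = m ; basis = V ; basis-S = VS ; basis-independent = ind
      ; basis-inSpan = span-generator V ; spans = span-generator V }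

    spanBasis : ∀ {N m} (V : Fin m → Fin N → Carrier) → (∀ j → Within S (V j)) → SpanBasis V
    spanBasis {N} {m} V VS = record
      { dim = rank ; basis = λ i → pivots i ∘ inj₁ ; basis-S = λ i → pivots-S i ∘ inj₁
      ; basis-independent = λ a _ → pivots-independent a
      ; basis-inSpan = λ i → let inSpan a aS h = pivots-inSpan i in inSpan a aS (h ∘ inj₁)
      ; spans = λ j → drop-rest (generates j) }
      where
      V⊥ : Fin m → Fin N ⊎ ⊥ → Carrier
      V⊥ j = Sum.[ V j , (λ ()) ]
      V⊥-S : ∀ j → Within S (V⊥ j)
      V⊥-S j (inj₁ k) = VS j k
      open Echelon (echelon N V⊥ V⊥-S)
      drop-rest : ∀ {x} → InSpan S (pivots ++ rest) x → InSpan S (λ i → pivots i ∘ inj₁) (x ∘ inj₁)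
      drop-rest {x} (inSpan a aS a·G≐x) = inSpan (λ i → a (i ↑ˡ #rest)) (λ i → aS _) λ k → begin
        linComb (λ i → a (i ↑ˡ #rest)) pivots (inj₁ k)              ≈⟨ +-identityʳ _ ⟨
        linComb (λ i → a (i ↑ˡ #rest)) pivots (inj₁ k) + 0#         ≈⟨ +-congˡ (linComb-zeroʳ _ rest (inj₁ k) (λ i → rest-vanishes i k)) ⟨
        linComb (λ i → a (i ↑ˡ #rest)) pivots (inj₁ k) + linComb (λ i → a (rank ↑ʳ i)) rest (inj₁ k)
                                                                     ≈⟨ linComb-++ rank a pivots rest (inj₁ k) ⟨
        linComb a (pivots ++ rest) (inj₁ k)                         ≈⟨ a·G≐x (inj₁ k) ⟩
        x (inj₁ k)                                                  ∎

    record KernelBasis {I : Set} {m} (V : Fin m → I → Carrier) : Set (c ⊔ ℓ) where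
      field
        nullity            : ℕ
        kernel             : Fin nullity → Fin m → Carrier
        kernel-S           : ∀ i → Within S (kernel i)
        kernel-independent : Independent S kernel
        kernel-relation    : ∀ i → linComb (kernel i) V ≐ 0v
        kernel-spans       : ∀ c → Within S c → linComb c V ≐ 0v → InSpan S kernel c
        kernel-spansᶠ      : ∀ c → linComb c V ≐ 0v → InSpan (Full F) kernel c

    -- Row reduction of the matrix [V | 1]: the rows that vanish on the V-block record the relations.
    module Relations {N m} (V : Fin m → Fin N → Carrier) (VS : ∀ j → Within S (V j)) where

      augmented : Fin m → Fin N ⊎ Fin m → Carrier
      augmented j = Sum.[ V j , unit j ]

      augmented-S : ∀ j → Within S (augmented j)
      augmented-S j (inj₁ k) = VS j k
      augmented-S j (inj₂ i) = S-unit j i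

      module E = Echelon (echelon N augmented augmented-S)

      κ : Fin E.#rest → Fin m → Carrier
      κ i = E.rest i ∘ inj₂

      κ-relation : ∀ i → linComb (κ i) V ≐ 0v
      κ-relation i k = begin
        linComb (κ i) V k    ≈⟨ linComb-congˡ V (λ y → trans (sym (b·R≐rest (inj₂ y))) (linComb-unitʳ b y)) k ⟩
        linComb b V k        ≈⟨ b·R≐rest (inj₁ k) ⟩
        E.rest i (inj₁ k)    ≈⟨ E.rest-vanishes i k ⟩
        0#                   ∎
        where open InSpan (E.rest-inSpan i) renaming (coeffs to b; combines to b·R≐rest)

      relation-inSpan : ∀ {T} → IsSubfield F T → (∀ {t} → S t → T t) →
                        ∀ a → Within T a → linComb a V ≐ 0v → InSpan T κ a
      relation-inSpan {T} isT S⊆T a aT a·V≐0 = inSpan bR (λ i → bT _) λ y → begin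
        linComb bR κ y                                              ≈⟨ +-identityˡ _ ⟨
        0# + linComb bR κ y                                         ≈⟨ +-congʳ (linComb-zeroˡ E.pivots bL≐0 (inj₂ y)) ⟨
        linComb bL E.pivots (inj₂ y) + linComb bR E.rest (inj₂ y)   ≈⟨ linComb-++ E.rank b E.pivots E.rest (inj₂ y) ⟨
        linComb b (E.pivots ++ E.rest) (inj₂ y)                     ≈⟨ b·G≐a·R (inj₂ y) ⟩
        linComb a augmented (inj₂ y)                                ≈⟨ linComb-unitʳ a y ⟩
        a y                                                         ∎
        where
        open InSpan (Spans.span-trans T isT (InSpan-map S⊆T ∘ E.generates) (inSpan a aT (λ _ → refl)))
          renaming (coeffs to b; coeffs-S to bT; combines to b·G≐a·R)
        bL : Fin E.rank → Carrier
        bL i = b (i ↑ˡ E.#rest)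
        bR : Fin E.#rest → Carrier
        bR i = b (E.rank ↑ʳ i)
        bL≐0 : bL ≐ 0v
        bL≐0 = E.pivots-independent bL λ k → begin
          linComb bL E.pivots (inj₁ k)                               ≈⟨ +-identityʳ _ ⟨
          linComb bL E.pivots (inj₁ k) + 0#                          ≈⟨ +-congˡ (linComb-zeroʳ bR E.rest (inj₁ k) (λ i → E.rest-vanishes i k)) ⟨
          linComb bL E.pivots (inj₁ k) + linComb bR E.rest (inj₁ k)  ≈⟨ linComb-++ E.rank b E.pivots E.rest (inj₁ k) ⟨
          linComb b (E.pivots ++ E.rest) (inj₁ k)                    ≈⟨ b·G≐a·R (inj₁ k) ⟩
          linComb a V k                                              ≈⟨ a·V≐0 k ⟩
          0#                                                         ∎

      module B = SpanBasis (spanBasis κ (λ i → E.rest-S i ∘ inj₂))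

      basis-relation : ∀ i → linComb (B.basis i) V ≐ 0v
      basis-relation i k = begin
        linComb (B.basis i) V k                   ≈⟨ linComb-congˡ V (sym ∘ b·κ≐basis) k ⟩
        linComb (linComb b κ) V k                 ≈⟨ linComb-assoc b κ V k ⟩
        linComb b (λ l → linComb (κ l) V) k       ≈⟨ linComb-zeroʳ b (λ l → linComb (κ l) V) k (λ l → κ-relation l k) ⟩
        0#                                        ∎
        where open InSpan (B.basis-inSpan i) renaming (coeffs to b; combines to b·κ≐basis)

    kernelBasis : ∀ {N m} (V : Fin m → Fin N → Carrier) → (∀ j → Within S (V j)) → KernelBasis V
    kernelBasis V VS = record
      { nullity = B.dim ; kernel = B.basis ; kernel-S = B.basis-S ; kernel-independent = B.basis-independent
      ; kernel-relation = basis-relation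
      ; kernel-spans = λ a aS a·V≐0 → span-trans B.spans (relation-inSpan isS id a aS a·V≐0)
      ; kernel-spansᶠ = λ a a·V≐0 → Spans.span-trans (Full F) Full-isSubfield (InSpan-map _ ∘ B.spans)
                                      (relation-inSpan Full-isSubfield _ a _ a·V≐0) }
      where open Relations V VS

    -- The coefficients of a basis of the span, followed by a basis of the relations, form a basis of S^m.
    module RankNullity {I : Set} {m} {V : Fin m → I → Carrier} (B : SpanBasis V) (K : KernelBasis V) where
      module B = SpanBasis B
      module K = KernelBasis K

      Bc : Fin B.dim → Fin m → Carrier
      Bc i = InSpan.coeffs (B.basis-inSpan i)

      Bc·V≐basis : ∀ i → linComb (Bc i) V ≐ B.basis i
      Bc·V≐basis i = InSpan.combines (B.basis-inSpan i)

      C : Fin (B.dim ℕ.+ K.nullity) → Fin m → Carrier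
      C = Bc ++ K.kernel

      C-S : ∀ l → Within S (C l)
      C-S = ++-all (Within S) (λ i → InSpan.coeffs-S (B.basis-inSpan i)) K.kernel-S

      unit-independent : Independent S (unit {m})
      unit-independent a _ a·unit≐0 j = trans (sym (linComb-unitʳ a j)) (a·unit≐0 j)

      C-independent : Independent S C
      C-independent a aS a·C≐0 = ++-≐0 B.dim a aL≐0 aR≐0
        where
        aL : Fin B.dim → Carrier
        aL i = a (i ↑ˡ K.nullity)
        aR : Fin K.nullity → Carrier
        aR i = a (B.dim ↑ʳ i)
        aL·basis≐0 : linComb aL B.basis ≐ 0v
        aL·basis≐0 k = begin
          linComb aL B.basis k                                        ≈⟨ linComb-congʳ aL (λ i k → sym (Bc·V≐basis i k)) k ⟩
          linComb aL (λ i → linComb (Bc i) V) k                       ≈⟨ +-identityʳ _ ⟨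
          linComb aL (λ i → linComb (Bc i) V) k + 0#                  ≈⟨ +-congˡ (linComb-zeroʳ aR (λ l → linComb (K.kernel l) V) k (λ l → K.kernel-relation l k)) ⟨
          linComb aL (λ i → linComb (Bc i) V) k + linComb aR (λ l → linComb (K.kernel l) V) k
                                                                      ≈⟨ linComb-++ B.dim a _ _ k ⟨
          linComb a ((λ i → linComb (Bc i) V) ++ (λ l → linComb (K.kernel l) V)) k
                                                                      ≈⟨ linComb-congʳ a (λ l → reflexive ∘ ≡.cong-app (∘-++ (λ c → linComb c V) Bc K.kernel l)) k ⟩
          linComb a (λ l → linComb (C l) V) k                         ≈⟨ linComb-assoc a C V k ⟨
          linComb (linComb a C) V k                                   ≈⟨ linComb-zeroˡ V a·C≐0 k ⟩
          0#                                                          ∎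
        aL≐0 : aL ≐ 0v
        aL≐0 = B.basis-independent aL (λ i → aS _) aL·basis≐0
        aR≐0 : aR ≐ 0v
        aR≐0 = K.kernel-independent aR (λ i → aS _) λ y → begin
          linComb aR K.kernel y                             ≈⟨ +-identityˡ _ ⟨
          0# + linComb aR K.kernel y                        ≈⟨ +-congʳ (linComb-zeroˡ Bc aL≐0 y) ⟨
          linComb aL Bc y + linComb aR K.kernel y           ≈⟨ linComb-++ B.dim a Bc K.kernel y ⟨
          linComb a C y                                     ≈⟨ a·C≐0 y ⟩
          0#                                                ∎

      unit-inSpan : ∀ j → InSpan S C (unit j)
      unit-inSpan j = inSpan (A ++ D) (++-all S AS DS) λ y → begin
        linComb (A ++ D) C y                       ≈⟨ linComb-++-++ B.dim A D Bc K.kernel y ⟩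
        linComb A Bc y + linComb D K.kernel y      ≈⟨ +-congˡ (D·kernel≐r y) ⟩
        linComb A Bc y + (unit j y - linComb A Bc y) ≈⟨ sym (+-assoc _ _ _) ⟩
        linComb A Bc y + unit j y - linComb A Bc y ≈⟨ xyx⁻¹≈y _ _ ⟩
        unit j y                                   ∎
        where
        open InSpan (B.spans j) renaming (coeffs to A; coeffs-S to AS; combines to A·basis≐Vj)
        r : Fin m → Carrier
        r y = unit j y - linComb A Bc y
        r-relation : linComb r V ≐ 0v
        r-relation k = begin
          linComb r V k                                            ≈⟨ linComb-sub (unit j) (linComb A Bc) V k ⟩
          linComb (unit j) V k - linComb (linComb A Bc) V k        ≈⟨ +-cong (linComb-unitˡ V j k) (-‿cong (linComb-assoc A Bc V k)) ⟩
          V j k - linComb A (λ i → linComb (Bc i) V) k             ≈⟨ +-congˡ (-‿cong (linComb-congʳ A Bc·V≐basis k)) ⟩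
          V j k - linComb A B.basis k                              ≈⟨ +-congˡ (-‿cong (A·basis≐Vj k)) ⟩
          V j k - V j k                                            ≈⟨ -‿inverseʳ _ ⟩
          0#                                                       ∎
        open InSpan (K.kernel-spans r (λ y → K-+ (S-unit j y) (K-neg (S-linComb AS (InSpan.coeffs-S ∘ B.basis-inSpan) y))) r-relation)
          renaming (coeffs to D; coeffs-S to DS; combines to D·kernel≐r)

    rank-nullity : ∀ {I : Set} {m} {V : Fin m → I → Carrier} (B : SpanBasis V) (K : KernelBasis V) →
                   SpanBasis.dim B ℕ.+ KernelBasis.nullity K ≡ m
    rank-nullity B K = dim-unique C-independent unit-independent (λ l → inSpan (C l) (C-S l) (linComb-unitʳ (C l))) unit-inSpan
      where open RankNullity B K

    rank-transpose-≤ : ∀ {N m} {V : Fin m → Fin N → Carrier} (B : SpanBasis V) (Bᵀ : SpanBasis (transpose V)) →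
                       SpanBasis.dim Bᵀ ℕ.≤ SpanBasis.dim B
    rank-transpose-≤ {m = m} {V} B Bᵀ = steinitz (transpose A) Bᵀ.basis Bᵀ.basis-independent
      (λ i → span-trans columns-inSpan (Bᵀ.basis-inSpan i))
      where
      module B = SpanBasis B
      module Bᵀ = SpanBasis Bᵀ
      A : Fin m → Fin B.dim → Carrier
      A t = InSpan.coeffs (B.spans t)
      columns-inSpan : ∀ k → InSpan S (transpose A) (transpose V k)
      columns-inSpan k = inSpan (λ i → B.basis i k) (λ i → B.basis-S i k) λ t →
        trans (sum-cong-≋ (λ i → *-comm (B.basis i k) (A t i))) (InSpan.combines (B.spans t) k)

    rank-transpose : ∀ {N m} {V : Fin m → Fin N → Carrier} (B : SpanBasis V) (Bᵀ : SpanBasis (transpose V)) →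
                     SpanBasis.dim B ≡ SpanBasis.dim Bᵀ
    rank-transpose B Bᵀ = ℕₚ.≤-antisym (rank-transpose-≤ Bᵀ B) (rank-transpose-≤ B Bᵀ)

    orthogonal-count : ∀ {N m} {V : Fin m → Fin N → Carrier} → (∀ t → Within S (V t)) →
                       (B : SpanBasis V) (K : KernelBasis (transpose V)) →
                       KernelBasis.nullity K ℕ.+ SpanBasis.dim B ≡ N
    orthogonal-count {V = V} VS B K = ≡.trans (ℕₚ.+-comm (KernelBasis.nullity K) (SpanBasis.dim B))
      (≡.trans (≡.cong (ℕ._+ KernelBasis.nullity K) (rank-transpose B Bᵀ)) (rank-nullity Bᵀ K))
      where
      Bᵀ : SpanBasis (transpose V)
      Bᵀ = spanBasis (transpose V) (λ k t → VS t k)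

    independent⇒independentᶠ : ∀ {N m} {U : Fin m → Fin N → Carrier} → (∀ j → Within S (U j)) →
                               Independent S U → Independent (Full F) U
    independent⇒independentᶠ {U = U} US ind c _ c·U≐0 j = begin
      c j                    ≈⟨ b·kernel≐c j ⟨
      linComb b kernel j     ≈⟨ linComb-zeroʳ b kernel j (λ l → ind (kernel l) (kernel-S l) (kernel-relation l) j) ⟩
      0#                     ∎
      where
      open KernelBasis (kernelBasis U US)
      open InSpan (kernel-spansᶠ c c·U≐0) renaming (coeffs to b; combines to b·kernel≐c)

    -- U ++ [E i] consists of p' + 1 vectors in a space of dimension at most p', so it has a nonzero relation;
    -- as U is independent, that relation involves E i.
    module Exchange {N p p'} {E : Fin p → Fin N → Carrier} {U : Fin p' → Fin N → Carrier}
                    (ES : ∀ i → Within S (E i)) (US : ∀ j → Within S (U j)) (U-independent : Independent S U)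
                    (p≤p' : p ℕ.≤ p') (U⊆E : ∀ j → InSpan S E (U j)) (i : Fin p) where

      W : Fin (p' ℕ.+ 1) → Fin N → Carrier
      W = U ++ (λ _ → E i)

      W-S : ∀ l → Within S (W l)
      W-S = ++-all (Within S) US (λ _ → ES i)

      module B = SpanBasis (spanBasis W W-S)
      module K = KernelBasis (kernelBasis W W-S)

      rank≤p' : B.dim ℕ.≤ p'
      rank≤p' = ℕₚ.≤-trans (steinitz E B.basis B.basis-independent
        (λ l → span-trans (++-all (InSpan S E) U⊆E (λ _ → span-generator E i)) (B.basis-inSpan l))) p≤p'

      some-index : ∀ {d ν} → d ℕ.+ ν ≡ p' ℕ.+ 1 → d ℕ.≤ p' → Fin ν
      some-index {ν = suc _} _ _ = zero
      some-index {d} {zero} d+0≡p'+1 d≤p' =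
        ⊥-elim (ℕₚ.m+1+n≰m p' (≡.subst (ℕ._≤ p') (≡.trans (≡.sym (ℕₚ.+-identityʳ d)) d+0≡p'+1) d≤p'))

      j₀ : Fin K.nullity
      j₀ = some-index (rank-nullity (spanBasis W W-S) (kernelBasis W W-S)) rank≤p'

      b : Fin (p' ℕ.+ 1) → Carrier
      b = K.kernel j₀

      bU : Fin p' → Carrier
      bU j = b (j ↑ˡ 1)

      r : Carrier
      r = b (p' ↑ʳ zero)

      relation : ∀ k → linComb bU U k + r * E i k ≈ 0#
      relation k = begin
        linComb bU U k + r * E i k                                 ≈⟨ +-congˡ (+-identityʳ _) ⟨
        linComb bU U k + linComb (λ l → b (p' ↑ʳ l)) (λ _ → E i) k ≈⟨ linComb-++ p' b U (λ _ → E i) k ⟨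
        linComb b W k                                              ≈⟨ K.kernel-relation j₀ k ⟩
        0#                                                         ∎

      coefficient≉0 : ¬ r ≈ 0#
      coefficient≉0 r≈0 = 1≉0 (trans (sym (unit-diag j₀))
        (K.kernel-independent (unit j₀) (S-unit j₀) (λ l → trans (linComb-unitˡ K.kernel j₀ l) (b≐0 l)) j₀))
        where
        bU≐0 : bU ≐ 0v
        bU≐0 = U-independent bU (λ j → K.kernel-S j₀ _) λ k →
          trans (sym (+-identityʳ _)) (trans (+-congˡ (sym (trans (*-congʳ r≈0) (zeroˡ _)))) (relation k))
        b≐0 : b ≐ 0v
        b≐0 = ++-≐0 p' b bU≐0 λ { zero → r≈0 }

      E[i]-inSpan : InSpan S U (E i)
      E[i]-inSpan = inSpan (λ j → - ρ * bU j) (λ j → K-* (K-neg ρS) (K.kernel-S j₀ _)) λ k →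
        trans (linComb-* (- ρ) bU U k) (solve-linear rρ≈1 (relation k))
        where
        inv : ∃[ ρ ] (S ρ × r * ρ ≈ 1#)
        inv = K-inv (K.kernel-S j₀ (p' ↑ʳ zero)) coefficient≉0
        ρ : Carrier
        ρ = proj₁ inv
        ρS : S ρ
        ρS = proj₁ (proj₂ inv)
        rρ≈1 : r * ρ ≈ 1#
        rρ≈1 = proj₂ (proj₂ inv)

    independent-spans : ∀ {N p p'} {E : Fin p → Fin N → Carrier} {U : Fin p' → Fin N → Carrier} →
                        (∀ i → Within S (E i)) → (∀ j → Within S (U j)) → Independent S U → p ℕ.≤ p' →
                        (∀ j → InSpan S E (U j)) → ∀ i → InSpan S U (E i)
    independent-spans ES US U-independent p≤p' U⊆E i = Exchange.E[i]-inSpan ES US U-independent p≤p' U⊆E i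

  -- Projections in F^n

  record BasisOf {I : Set} (P : (I → Carrier) → Set (c ⊔ ℓ)) : Set (c ⊔ ℓ) where
    field
      dim               : ℕ
      basis             : Fin dim → I → Carrier
      basis-independent : Independent (Full F) basis
      basis-in          : ∀ i → P (basis i)
      spans             : ∀ {v} → P v → InSpan (Full F) basis v

  infix 7 _·_
  _·_ : ∀ {n} → (Fin n → Carrier) → (Fin n → Carrier) → Carrier
  z · y = sum (λ k → z k * y k)

  ·-comm : ∀ {n} (z y : Fin n → Carrier) → z · y ≈ y · z
  ·-comm z y = sum-cong-≋ (λ k → *-comm (z k) (y k))

  ·-sub : ∀ {n} (z z' y : Fin n → Carrier) → (λ k → z k - z' k) · y ≈ z · y - z' · y
  ·-sub z z' y = begin
    sum (λ k → (z k - z' k) * y k)                ≈⟨ sum-cong-≋ (λ k → trans (distribʳ (y k) (z k) (- z' k)) (+-congˡ (sym (-‿distribˡ-* (z' k) (y k))))) ⟩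
    sum (λ k → z k * y k + - (z' k * y k))        ≈⟨ ∑-distrib-+ (λ k → z k * y k) (λ k → - (z' k * y k)) ⟩
    z · y + sum (λ k → - (z' k * y k))            ≈⟨ +-congˡ (sum-neg (λ k → z' k * y k)) ⟩
    z · y - z' · y                                ∎

  linComb-· : ∀ {m n} (a : Fin m → Carrier) (V : Fin m → Fin n → Carrier) (y : Fin n → Carrier) →
              linComb a V · y ≈ sum (λ i → a i * (V i · y))
  linComb-· a V y = linComb-assoc a V (λ k (_ : ⊤) → y k) tt

  module Projections (n : ℕ) where
    open OverSubfield (Full F) Full-isSubfield

    Orthogonal : ∀ {k} → (Fin k → Fin n → Carrier) → (Fin n → Carrier) → Set ℓ
    Orthogonal x z = linComb z (transpose x) ≐ 0v

    Projection : ∀ {p r} → (Fin r → Fin n → Carrier) → ((Fin n → Carrier) → Set p) →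
                 (Fin r → Carrier) → Set (c ⊔ ℓ ⊔ p)
    Projection u P v = ∃[ z ] (P z × (λ t → z · u t) ≐ v)

    basisOf-dim : ∀ {I : Set} {P} {m} {V : Fin m → I → Carrier} (Bp : BasisOf P) (B : SpanBasis V) →
                  (∀ {v} → P v → InSpan (Full F) V v) → (∀ j → P (V j)) → BasisOf.dim Bp ≡ SpanBasis.dim B
    basisOf-dim Bp B P⊆V V⊆P = dim-unique Bp.basis-independent B.basis-independent
      (λ i → span-trans B.spans (P⊆V (Bp.basis-in i)))
      (λ i → span-trans (λ j → Bp.spans (V⊆P j)) (B.basis-inSpan i))
      where
      module Bp = BasisOf Bp
      module B = SpanBasis B

    -- With y a basis of x^⊥, Π_u(x^⊥) is spanned by the vectors h_i = (y_i · u_t)_t, and the relations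
    -- among the h_i correspond to the vectors of x^⊥ orthogonal to u, i.e. to ⟨x, u⟩^⊥.
    module ProjectionOfOrthogonal {k r} (x : Fin k → Fin n → Carrier) (u : Fin r → Fin n → Carrier) where

      Kx : KernelBasis (transpose x)
      Kx = kernelBasis (transpose x) _
      module Kx = KernelBasis Kx

      y : Fin Kx.nullity → Fin n → Carrier
      y = Kx.kernel

      h : Fin Kx.nullity → Fin r → Carrier
      h i t = y i · u t

      Kh : KernelBasis h
      Kh = kernelBasis h _
      module Kh = KernelBasis Kh

      Kxu : KernelBasis (transpose (x ++ u))
      Kxu = kernelBasis (transpose (x ++ u)) _
      module Kxu = KernelBasis Kxu

      combination-of-y : ∀ a {z} → linComb a y ≐ z → linComb a h ≐ (λ t → z · u t)
      combination-of-y a a·y≐z t = trans (sym (linComb-· a y (u t))) (sum-cong-≋ (λ l → *-congʳ (a·y≐z l)))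

      projection⊆h : ∀ {v} → Projection u (Orthogonal x) v → InSpan (Full F) h v
      projection⊆h (z , z⊥x , z·u≐v) = let inSpan a _ a·y≐z = Kx.kernel-spansᶠ z z⊥x in
        inSpan a _ (λ t → trans (combination-of-y a a·y≐z t) (z·u≐v t))

      h⊆projection : ∀ i → Projection u (Orthogonal x) (h i)
      h⊆projection i = y i , Kx.kernel-relation i , λ _ → refl

      o : Fin Kh.nullity → Fin n → Carrier
      o i = linComb (Kh.kernel i) y

      o-independent : Independent (Full F) o
      o-independent a _ a·o≐0 = Kh.kernel-independent a _
        (Kx.kernel-independent (linComb a Kh.kernel) _ (λ l → trans (linComb-assoc a Kh.kernel y l) (a·o≐0 l)))

      o⊥xu : ∀ i → Orthogonal (x ++ u) (o i)
      o⊥xu i = ++-all (λ v → o i · v ≈ 0#)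
        (λ j → trans (linComb-· (Kh.kernel i) y (x j))
                     (linComb-zeroʳ (Kh.kernel i) (λ l _ → y l · x j) tt (λ l → Kx.kernel-relation l j)))
        (λ t → trans (sym (combination-of-y (Kh.kernel i) (λ _ → refl) t)) (Kh.kernel-relation i t))

      Kxu⊆o : ∀ l → InSpan (Full F) o (Kxu.kernel l)
      Kxu⊆o l = inSpan d _ λ m → begin
        linComb d o m                       ≈⟨ linComb-assoc d Kh.kernel y m ⟨
        linComb (linComb d Kh.kernel) y m   ≈⟨ linComb-congˡ y d·kernel≐a m ⟩
        linComb a y m                       ≈⟨ a·y≐z m ⟩
        z m                                 ∎
        where
        z : Fin n → Carrier
        z = Kxu.kernel l
        z⊥x : Orthogonal x z
        z⊥x j = ≡.subst (λ v → z · v ≈ 0#) (Vecₚ.lookup-++ˡ x u j) (Kxu.kernel-relation l (j ↑ˡ r))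
        z⊥u : Orthogonal u z
        z⊥u t = ≡.subst (λ v → z · v ≈ 0#) (Vecₚ.lookup-++ʳ x u t) (Kxu.kernel-relation l (k ↑ʳ t))
        open InSpan (Kx.kernel-spansᶠ z z⊥x) renaming (coeffs to a; combines to a·y≐z)
        open InSpan (Kh.kernel-spansᶠ a (λ t → trans (combination-of-y a a·y≐z t) (z⊥u t)))
          renaming (coeffs to d; combines to d·kernel≐a)

      νh≡νxu : Kh.nullity ≡ Kxu.nullity
      νh≡νxu = dim-unique o-independent Kxu.kernel-independent (λ i → Kxu.kernel-spansᶠ (o i) (o⊥xu i)) Kxu⊆o

    dim-projection-orthogonal : ∀ {k r} {x : Fin k → Fin n → Carrier} {u : Fin r → Fin n → Carrier} →
      Independent (Full F) x → (Bu : BasisOf (Projection u (Orthogonal x))) → (B : SpanBasis (x ++ u)) →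
      BasisOf.dim Bu ℕ.+ k ≡ SpanBasis.dim B
    dim-projection-orthogonal {k} {r} {x} {u} x-independent Bu B =
      ℕₚ.+-cancelʳ-≡ Kh.nullity (s ℕ.+ k) d (≡.trans (xy∙z≈xz∙y s k Kh.nullity)
        (≡.trans (≡.cong (ℕ._+ k) s+νh≡νy) (≡.trans νy+k≡n (≡.sym d+νh≡n))))
      where
      open ProjectionOfOrthogonal x u
      open import Algebra.Properties.CommutativeSemigroup ℕₚ.+-commutativeSemigroup using (xy∙z≈xz∙y)
      s d : ℕ
      s = BasisOf.dim Bu
      d = SpanBasis.dim B
      s+νh≡νy : s ℕ.+ Kh.nullity ≡ Kx.nullity
      s+νh≡νy = ≡.trans (≡.cong (ℕ._+ Kh.nullity) (basisOf-dim Bu (spanBasis h _) projection⊆h h⊆projection))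
                        (rank-nullity (spanBasis h _) Kh)
      νy+k≡n : Kx.nullity ℕ.+ k ≡ n
      νy+k≡n = orthogonal-count _ (independent-spanBasis x _ x-independent) Kx
      d+νh≡n : d ℕ.+ Kh.nullity ≡ n
      d+νh≡n = ≡.trans (ℕₚ.+-comm d Kh.nullity) (≡.trans (≡.cong (ℕ._+ d) νh≡νxu) (orthogonal-count _ B Kxu))

    orthogonal-spanned : ∀ {q r} {u : Fin r → Fin n → Carrier} {w : Fin q → Fin n → Carrier} →
      Independent (Full F) u → Independent (Full F) w → q ℕ.+ r ≡ n → (∀ t t' → w t · u t' ≈ 0#) →
      ∀ {z} → Orthogonal w z → InSpan (Full F) u z
    orthogonal-spanned {q} {r} {u} {w} u-independent w-independent q+r≡n w⊥u {z} z⊥w =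
      span-trans (independent-spans (λ _ _ → _) (λ _ _ → _) u-independent (ℕₚ.≤-reflexive νw≡r) u⊆Kw)
                 (Kw.kernel-spansᶠ z z⊥w)
      where
      Kw : KernelBasis (transpose w)
      Kw = kernelBasis (transpose w) _
      module Kw = KernelBasis Kw
      νw≡r : Kw.nullity ≡ r
      νw≡r = ℕₚ.+-cancelʳ-≡ q Kw.nullity r (≡.trans (orthogonal-count _ (independent-spanBasis w _ w-independent) Kw)
                                                   (≡.trans (≡.sym q+r≡n) (ℕₚ.+-comm q r)))
      u⊆Kw : ∀ t → InSpan (Full F) Kw.kernel (u t)
      u⊆Kw t = Kw.kernel-spansᶠ (u t) (λ t' → trans (·-comm (u t) (w t')) (w⊥u t' t))

    -- Π_w(⟨x⟩) is spanned by the vectors g_j = (x_j · w_t)_t. When ⟨u⟩ = ⟨w⟩^⊥, a relation among the g_j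
    -- is the x-part of a relation among x ++ u, and conversely.
    module ProjectionOfSpan {k q r} (x : Fin k → Fin n → Carrier) {u : Fin r → Fin n → Carrier} (w : Fin q → Fin n → Carrier)
                            (u-independent : Independent (Full F) u) (w⊥⊆u : ∀ {z} → Orthogonal w z → InSpan (Full F) u z)
                            (w⊥u : ∀ t t' → w t · u t' ≈ 0#) where

      K : KernelBasis (x ++ u)
      K = kernelBasis (x ++ u) _
      module K = KernelBasis K

      g : Fin k → Fin q → Carrier
      g j t = x j · w t

      Kg : KernelBasis g
      Kg = kernelBasis g _
      module Kg = KernelBasis Kg

      combination-of-x : ∀ a {z} → linComb a x ≐ z → linComb a g ≐ (λ t → z · w t)
      combination-of-x a a·x≐z t = trans (sym (linComb-· a x (w t))) (sum-cong-≋ (λ l → *-congʳ (a·x≐z l)))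

      projection⊆g : ∀ {v} → Projection w (InSpan (Full F) x) v → InSpan (Full F) g v
      projection⊆g (z , inSpan a _ a·x≐z , z·w≐v) = inSpan a _ (λ t → trans (combination-of-x a a·x≐z t) (z·w≐v t))

      g⊆projection : ∀ j → Projection w (InSpan (Full F) x) (g j)
      g⊆projection j = x j , span-generator x j , λ _ → refl

      span-u⊥w : ∀ {z} → InSpan (Full F) u z → Orthogonal w z
      span-u⊥w (inSpan a _ a·u≐z) t = begin
        sum (λ l → _ * w t l)            ≈⟨ sum-cong-≋ (λ l → *-congʳ (a·u≐z l)) ⟨
        linComb a u · w t                ≈⟨ linComb-· a u (w t) ⟩
        sum (λ i → a i * (u i · w t))    ≈⟨ sum-zero (λ i → trans (*-congˡ (trans (·-comm (u i) (w t)) (w⊥u t i))) (zeroʳ _)) ⟩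
        0#                               ∎

      left : (Fin (k ℕ.+ r) → Carrier) → Fin k → Carrier
      left ρ j = ρ (j ↑ˡ r)

      right : (Fin (k ℕ.+ r) → Carrier) → Fin r → Carrier
      right ρ i = ρ (k ↑ʳ i)

      left-inSpan-u : ∀ ρ → linComb ρ (x ++ u) ≐ 0v → InSpan (Full F) u (linComb (left ρ) x)
      left-inSpan-u ρ ρ-relation = inSpan (λ i → - right ρ i) _ λ m → begin
        linComb (λ i → - right ρ i) u m     ≈⟨ linComb-neg (right ρ) u m ⟩
        - linComb (right ρ) u m             ≈⟨ inverseˡ-unique _ _ (trans (sym (linComb-++ k ρ x u m)) (ρ-relation m)) ⟨
        linComb (left ρ) x m                ∎

      β : Fin K.nullity → Fin k → Carrier
      β l = left (K.kernel l)

      β⊆Kg : ∀ l → InSpan (Full F) Kg.kernel (β l)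
      β⊆Kg l = Kg.kernel-spansᶠ (β l) λ t →
        trans (combination-of-x (β l) (λ _ → refl) t) (span-u⊥w (left-inSpan-u (K.kernel l) (K.kernel-relation l)) t)

      Kg⊆β : ∀ l → InSpan (Full F) β (Kg.kernel l)
      Kg⊆β l = inSpan e _ λ j → begin
        linComb e β j                        ≈⟨ e·kernel≐ρ (j ↑ˡ r) ⟩
        (a ++ (λ i → - d i)) (j ↑ˡ r)        ≡⟨ Vecₚ.lookup-++ˡ a _ j ⟩
        a j                                  ∎
        where
        a : Fin k → Carrier
        a = Kg.kernel l
        a·x⊥w : Orthogonal w (linComb a x)
        a·x⊥w t = trans (sym (combination-of-x a (λ _ → refl) t)) (Kg.kernel-relation l t)
        open InSpan (w⊥⊆u a·x⊥w) renaming (coeffs to d; combines to d·u≐a·x)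
        ρ-relation : linComb (a ++ (λ i → - d i)) (x ++ u) ≐ 0v
        ρ-relation m = begin
          linComb (a ++ (λ i → - d i)) (x ++ u) m             ≈⟨ linComb-++-++ k a (λ i → - d i) x u m ⟩
          linComb a x m + linComb (λ i → - d i) u m          ≈⟨ +-congˡ (linComb-neg d u m) ⟩
          linComb a x m - linComb d u m                      ≈⟨ +-congˡ (-‿cong (d·u≐a·x m)) ⟩
          linComb a x m - linComb a x m                      ≈⟨ -‿inverseʳ _ ⟩
          0#                                                 ∎
        open InSpan (K.kernel-spansᶠ _ ρ-relation) renaming (coeffs to e; combines to e·kernel≐ρ)

      β-independent : Independent (Full F) β
      β-independent e _ e·β≐0 = K.kernel-independent e _ (++-≐0 k ρ e·β≐0 right≐0)
        where
        ρ : Fin (k ℕ.+ r) → Carrier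
        ρ = linComb e K.kernel
        ρ-relation : linComb ρ (x ++ u) ≐ 0v
        ρ-relation m = trans (linComb-assoc e K.kernel (x ++ u) m)
                             (linComb-zeroʳ e (λ l → linComb (K.kernel l) (x ++ u)) m (λ l → K.kernel-relation l m))
        right≐0 : right ρ ≐ 0v
        right≐0 = u-independent (right ρ) _ λ m → begin
          linComb (right ρ) u m                          ≈⟨ +-identityˡ _ ⟨
          0# + linComb (right ρ) u m                     ≈⟨ +-congʳ (linComb-zeroˡ x e·β≐0 m) ⟨
          linComb (left ρ) x m + linComb (right ρ) u m   ≈⟨ linComb-++ k ρ x u m ⟨
          linComb ρ (x ++ u) m                           ≈⟨ ρ-relation m ⟩
          0#                                             ∎

      νxu≡νg : K.nullity ≡ Kg.nullity
      νxu≡νg = dim-unique β-independent Kg.kernel-independent β⊆Kg Kg⊆β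

    dim-span-projection : ∀ {k q r} {x : Fin k → Fin n → Carrier} {u : Fin r → Fin n → Carrier} {w : Fin q → Fin n → Carrier} →
      Independent (Full F) u → (∀ {z} → Orthogonal w z → InSpan (Full F) u z) → (∀ t t' → w t · u t' ≈ 0#) →
      (Bw : BasisOf (Projection w (InSpan (Full F) x))) → (B : SpanBasis (x ++ u)) →
      SpanBasis.dim B ≡ BasisOf.dim Bw ℕ.+ r
    dim-span-projection {k} {q} {r} {x} {u} {w} u-independent w⊥⊆u w⊥u Bw B =
      ℕₚ.+-cancelʳ-≡ Kg.nullity d (a ℕ.+ r)
        (≡.trans d+νg≡k+r (≡.trans (≡.cong (ℕ._+ r) (≡.sym a+νg≡k)) (xy∙z≈xz∙y a Kg.nullity r)))
      where
      open ProjectionOfSpan x w u-independent w⊥⊆u w⊥u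
      open import Algebra.Properties.CommutativeSemigroup ℕₚ.+-commutativeSemigroup using (xy∙z≈xz∙y)
      a d : ℕ
      a = BasisOf.dim Bw
      d = SpanBasis.dim B
      d+νg≡k+r : d ℕ.+ Kg.nullity ≡ k ℕ.+ r
      d+νg≡k+r = ≡.subst (λ ν → d ℕ.+ ν ≡ k ℕ.+ r) νxu≡νg (rank-nullity B K)
      a+νg≡k : a ℕ.+ Kg.nullity ≡ k
      a+νg≡k = ≡.trans (≡.cong (ℕ._+ Kg.nullity) (basisOf-dim Bw (spanBasis g _) projection⊆g g⊆projection))
                       (rank-nullity (spanBasis g _) Kg)

    projection-dimensions : ∀ {k q r} {x : Fin k → Fin n → Carrier} {u : Fin r → Fin n → Carrier} {w : Fin q → Fin n → Carrier} →
      Independent (Full F) x → Independent (Full F) u → Independent (Full F) w →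
      q ℕ.+ r ≡ n → (∀ t t' → w t · u t' ≈ 0#) →
      (Bw : BasisOf (Projection w (InSpan (Full F) x))) → (Bu : BasisOf (Projection u (Orthogonal x))) →
      BasisOf.dim Bu ℕ.+ k ≡ BasisOf.dim Bw ℕ.+ r
    projection-dimensions {x = x} {u} x-independent u-independent w-independent q+r≡n w⊥u Bw Bu = ≡.trans
      (dim-projection-orthogonal x-independent Bu B)
      (dim-span-projection u-independent (orthogonal-spanned u-independent w-independent q+r≡n w⊥u) w⊥u Bw B)
      where
      B : SpanBasis (x ++ u)
      B = spanBasis (x ++ u) _

-- Sum-rank data as families of vectors in F^n

Blocks : (b : ℕ) → (Fin b → ℕ) → Set
Blocks b l = Σ (Fin b) (λ i → Fin (l i))

flatten : ∀ b (l : Fin b → ℕ) → Blocks b l → Fin (sumℕ b l)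
flatten (suc b) l (zero , j) = j ↑ˡ sumℕ b (l ∘ suc)
flatten (suc b) l (suc i , j) = l zero ↑ʳ flatten b (l ∘ suc) (i , j)

unflatten : ∀ b (l : Fin b → ℕ) → Fin (sumℕ b l) → Blocks b l
unflatten (suc b) l t = Sum.[ (zero ,_) , Product.map suc id ∘ unflatten b (l ∘ suc) ] (Fin.splitAt (l zero) t)

unflatten-flatten : ∀ b (l : Fin b → ℕ) p → unflatten b l (flatten b l p) ≡ p
unflatten-flatten (suc b) l (zero , j) = ≡.cong Sum.[ (zero ,_) , _ ] (Finₚ.splitAt-↑ˡ (l zero) j (sumℕ b (l ∘ suc)))
unflatten-flatten (suc b) l (suc i , j) = ≡.trans
  (≡.cong Sum.[ (zero ,_) , Product.map suc id ∘ unflatten b (l ∘ suc) ]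
          (Finₚ.splitAt-↑ʳ (l zero) (sumℕ b (l ∘ suc)) (flatten b (l ∘ suc) (i , j))))
  (≡.cong (Product.map suc id) (unflatten-flatten b (l ∘ suc) (i , j)))

flatten-unflatten : ∀ b (l : Fin b → ℕ) t → flatten b l (unflatten b l t) ≡ t
flatten-unflatten (suc b) l t with Fin.splitAt (l zero) t in eq
... | inj₁ j = Finₚ.splitAt⁻¹-↑ˡ eq
... | inj₂ t' = ≡.trans (≡.cong (l zero ↑ʳ_) (flatten-unflatten b (l ∘ suc) t')) (Finₚ.splitAt⁻¹-↑ʳ eq)

sumℕ-+ : ∀ b (f g : Fin b → ℕ) → sumℕ b (λ i → f i ℕ.+ g i) ≡ sumℕ b f ℕ.+ sumℕ b g
sumℕ-+ zero f g = ≡.refl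
sumℕ-+ (suc b) f g = ≡.trans (≡.cong (f zero ℕ.+ g zero ℕ.+_) (sumℕ-+ b (f ∘ suc) (g ∘ suc)))
  (interchange (f zero) (g zero) (sumℕ b (f ∘ suc)) (sumℕ b (g ∘ suc)))
  where open import Algebra.Properties.CommutativeSemigroup ℕₚ.+-commutativeSemigroup using (interchange)

sumℕ-cong : ∀ b {f g : Fin b → ℕ} → (∀ i → f i ≡ g i) → sumℕ b f ≡ sumℕ b g
sumℕ-cong zero _ = ≡.refl
sumℕ-cong (suc b) f≡g = ≡.cong₂ ℕ._+_ (f≡g zero) (sumℕ-cong b (f≡g ∘ suc))

module SumRank {c ℓ} (F : Field c ℓ) (fin : Finite F) where

  open Field F hiding (zero)
  open LinearAlgebra F (≈-decidable F fin)
  open import Relation.Binary.Reasoning.Setoid setoid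

  Σ≡sum : ∀ m (f : Fin m → Carrier) → Σ[_] F m f ≡ sum f
  Σ≡sum zero f = ≡.refl
  Σ≡sum (suc m) f = ≡.cong (f zero +_) (Σ≡sum m (f ∘ suc))

  lincomb≐linComb : ∀ {s : Shape F} {d} (a : Fin d → Carrier) (v : Fin d → Vec F s) → lincomb F a v ≐ linComb a v
  lincomb≐linComb {d = d} a v k = reflexive (Σ≡sum d (λ j → a j * v j k))

  module _ {K : Carrier → Set (c ⊔ ℓ)} {s : Shape F} {P : Vec F s → Set (c ⊔ ℓ)} {d} {v : Fin d → Vec F s}
           (B : IsBasis F K P v) where

    IsBasis⇒independent : Independent K v
    IsBasis⇒independent a aK a·v≐0 = IsBasis.independent B a aK (λ k → trans (lincomb≐linComb a v k) (a·v≐0 k))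

    IsBasis⇒spans : ∀ {x} → P x → InSpan K v x
    IsBasis⇒spans Px = let (a , aK , a·v≋x) = IsBasis.spanning B Px in
      inSpan a aK (λ k → trans (sym (lincomb≐linComb a v k)) (a·v≋x k))

  hat : ∀ {m} → Vec F (one F m) → Fin m → Carrier
  hat v k = v (zero , k)

  unhat : ∀ {m} → (Fin m → Carrier) → Vec F (one F m)
  unhat v (zero , k) = v k

  module Block {m} {K : Carrier → Set (c ⊔ ℓ)} (isK : IsSubfield F K) {L : Vec F (one F m) → Set (c ⊔ ℓ)}
               {Ns} {S : Fin Ns → Vec F (one F m)} (basisL : IsBasis F K L S)
               {Na} {A : Fin Na → Vec F (one F m)} (basisL⊥ : IsBasis F K (Orth F K L) A) where
    open OverSubfield K isK

    dot-one : ∀ (x y : Vec F (one F m)) → dot F {one F m} x y ≈ hat x · hat y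
    dot-one x y = trans (+-identityʳ _) (reflexive (Σ≡sum m (λ k → x (zero , k) * y (zero , k))))

    hat-independent : ∀ {P} {d} {V : Fin d → Vec F (one F m)} → IsBasis F K P V → Independent K (hat ∘ V)
    hat-independent B a aK a·V≐0 = IsBasis⇒independent B a aK (λ { (zero , k) → a·V≐0 k })

    hat-K : ∀ {P} {d} {V : Fin d → Vec F (one F m)} → IsBasis F K P V → ∀ j → Within K (hat (V j))
    hat-K B j k = IsBasis.coeffs-in-K B j (zero , k)

    hat-independentᶠ : ∀ {P} {d} {V : Fin d → Vec F (one F m)} → IsBasis F K P V → Independent (Full F) (hat ∘ V)
    hat-independentᶠ B = independent⇒independentᶠ (hat-K B) (hat-independent B)

    rank-unique : ∀ {N} → HasDim F K L N → N ≡ Ns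
    rank-unique (_ , basisR) = dim-unique (hat-independent basisR) (hat-independent basisL)
      (λ j → hat-inSpan (IsBasis⇒spans basisL (IsBasis.inP basisR j)))
      (λ j → hat-inSpan (IsBasis⇒spans basisR (IsBasis.inP basisL j)))
      where
      hat-inSpan : ∀ {d} {V : Fin d → Vec F (one F m)} {x} → InSpan K V x → InSpan K (hat ∘ V) (hat x)
      hat-inSpan (inSpan a aK a·V≐x) = inSpan a aK (λ k → a·V≐x (zero , k))

    complementary : Na ℕ.+ Ns ≡ m
    complementary = ≡.trans (≡.cong (ℕ._+ Ns) (dim-unique (hat-independent basisL⊥) K⊥.kernel-independent Â⊆K⊥ K⊥⊆Â))
                            (orthogonal-count (hat-K basisL) (independent-spanBasis _ (hat-K basisL) (hat-independent basisL)) K⊥)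
      where
      K⊥ : KernelBasis (transpose (hat ∘ S))
      K⊥ = kernelBasis (transpose (hat ∘ S)) (λ k t → hat-K basisL t k)
      module K⊥ = KernelBasis K⊥
      K⊥⊆Â : ∀ l → InSpan K (hat ∘ A) (K⊥.kernel l)
      K⊥⊆Â l = let inSpan a aK a·A≐z = IsBasis⇒spans basisL⊥ z∈L⊥ in inSpan a aK (λ k → a·A≐z (zero , k))
        where
        z : Fin m → Carrier
        z = K⊥.kernel l
        z∈L⊥ : Orth F K L (unhat z)
        z∈L⊥ = (λ { (zero , k) → K⊥.kernel-S l k }) , λ y y∈L → begin
          dot F {one F m} (unhat z) y           ≈⟨ dot-one (unhat z) y ⟩
          z · hat y                             ≈⟨ ·-comm z (hat y) ⟩
          hat y · z                             ≈⟨ sum-cong-≋ (λ k → *-congʳ (InSpan.combines (IsBasis⇒spans basisL y∈L) (zero , k))) ⟨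
          linComb _ (hat ∘ S) · z               ≈⟨ linComb-· _ (hat ∘ S) z ⟩
          sum (λ j → _ * (hat (S j) · z))       ≈⟨ sum-zero (λ j → trans (*-congˡ (trans (·-comm (hat (S j)) z) (K⊥.kernel-relation l j))) (zeroʳ _)) ⟩
          0#                                    ∎
      Â⊆K⊥ : ∀ j → InSpan K K⊥.kernel (hat (A j))
      Â⊆K⊥ j = K⊥.kernel-spans (hat (A j)) (hat-K basisL⊥ j)
        (λ t → trans (sym (dot-one (A j) (S t))) (proj₂ (IsBasis.inP basisL⊥ j) (S t) (IsBasis.inP basisL t)))

  sum-unflatten : ∀ b (N : Fin b → ℕ) (f : Blocks b N → Carrier) →
                  sum (f ∘ unflatten b N) ≈ sum (λ i → sum (λ j → f (i , j)))
  sum-unflatten zero N f = refl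
  sum-unflatten (suc b) N f = begin
    sum (f ∘ unflatten (suc b) N)
      ≈⟨ sum-++ (N zero) (f ∘ unflatten (suc b) N) ⟩
    sum (λ j → f (unflatten (suc b) N (j ↑ˡ sumℕ b (N ∘ suc)))) + sum (λ t → f (unflatten (suc b) N (N zero ↑ʳ t)))
      ≡⟨ ≡.cong₂ _+_ (sum-cong-≗ (λ j → ≡.cong f (unflatten-flatten (suc b) N (zero , j))))
                     (sum-cong-≗ (λ t → ≡.cong f (≡.cong Sum.[ (zero ,_) , Product.map suc id ∘ unflatten b (N ∘ suc) ]
                                                          (Finₚ.splitAt-↑ʳ (N zero) (sumℕ b (N ∘ suc)) t)))) ⟩
    sum (λ j → f (zero , j)) + sum (f ∘ Product.map suc id ∘ unflatten b (N ∘ suc))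
      ≈⟨ +-congˡ (sum-unflatten b (N ∘ suc) (f ∘ Product.map suc id)) ⟩
    sum (λ j → f (zero , j)) + sum (λ i → sum (λ j → f (suc i , j)))  ∎

  module Coordinates (b : ℕ) (ns : Fin b → ℕ) where
    open Projections (sumℕ b ns) public using (Orthogonal; Projection; projection-dimensions)

    X : Set
    X = Blocks b ns

    ♭ : (X → Carrier) → Fin (sumℕ b ns) → Carrier
    ♭ z = z ∘ unflatten b ns

    dot-blocks : ∀ (z y : X → Carrier) → dot F {shape b ns} z y ≈ sum (λ i → sum (λ k → z (i , k) * y (i , k)))
    dot-blocks z y = reflexive (≡.trans (Σ≡sum b _) (sum-cong-≗ (λ i → Σ≡sum (ns i) (λ k → z (i , k) * y (i , k)))))

    dot-♭ : ∀ (z y : X → Carrier) → dot F {shape b ns} z y ≈ ♭ z · ♭ y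
    dot-♭ z y = trans (dot-blocks z y) (sym (sum-unflatten b ns (λ p → z p * y p)))

    embed : (i : Fin b) → (Fin (ns i) → Carrier) → X → Carrier
    embed i v (i' , k) with i Fin.≟ i'
    ... | yes ≡.refl = v k
    ... | no _ = 0#

    embed-diag : ∀ i v k → embed i v (i , k) ≈ v k
    embed-diag i v k with i Fin.≟ i
    ... | yes ≡.refl = refl
    ... | no i≢i = ⊥-elim (i≢i ≡.refl)

    embed-off : ∀ {i i'} v k → i ≢ i' → embed i v (i' , k) ≈ 0#
    embed-off {i} {i'} v k i≢i' with i Fin.≟ i'
    ... | yes i≡i' = ⊥-elim (i≢i' i≡i')
    ... | no _ = refl

    dot-embed : ∀ (z : X → Carrier) i v → dot F {shape b ns} z (embed i v) ≈ (λ k → z (i , k)) · v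
    dot-embed z i v = begin
      dot F {shape b ns} z (embed i v)                       ≈⟨ dot-blocks z (embed i v) ⟩
      sum (λ i' → sum (λ k → z (i' , k) * embed i v (i' , k))) ≈⟨ sum-single i _ (λ i' i'≢i → sum-zero (λ k →
                                                                     trans (*-congˡ (embed-off v k (i'≢i ∘ ≡.sym))) (zeroʳ _))) ⟩
      sum (λ k → z (i , k) * embed i v (i , k))              ≈⟨ sum-cong-≋ (λ k → *-congˡ (embed-diag i v k)) ⟩
      (λ k → z (i , k)) · v                                  ∎

    dot-embed-off : ∀ {i i'} v v' → i ≢ i' → dot F {shape b ns} (embed i v) (embed i' v') ≈ 0#
    dot-embed-off {i} {i'} v v' i≢i' = trans (dot-embed (embed i v) i' v')
      (sum-zero (λ k → trans (*-congʳ (embed-off v k i≢i')) (zeroˡ _)))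

    dot-embed-diag : ∀ i v v' → dot F {shape b ns} (embed i v) (embed i v') ≈ v · v'
    dot-embed-diag i v v' = trans (dot-embed (embed i v) i v') (sum-cong-≋ (λ k → *-congʳ (embed-diag i v k)))

    -- The rows of A = diag(A_1, …, A_ℓ), as vectors of F^n.
    module Rows {N : Fin b → ℕ} (As : (i : Fin b) → Fin (N i) → Vec F (one F (ns i))) where

      row : Blocks b N → X → Carrier
      row (i , j) = embed i (hat (As i j))

      rows : Fin (sumℕ b N) → Fin (sumℕ b ns) → Carrier
      rows t = ♭ (row (unflatten b N t))

      Π-rows : ∀ z t → Π F As z (unflatten b N t) ≈ ♭ z · rows t
      Π-rows z t = begin
        Π F As z (i , j)                       ≡⟨ Σ≡sum (ns i) _ ⟩
        (λ k → z (i , k)) · hat (As i j)       ≈⟨ dot-embed z i (hat (As i j)) ⟨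
        dot F {shape b ns} z (row (i , j))     ≈⟨ dot-♭ z (row (i , j)) ⟩
        ♭ z · rows t                           ∎
        where
        i : Fin b
        i = proj₁ (unflatten b N t)
        j : Fin (N i)
        j = proj₂ (unflatten b N t)

      rows-independent : (∀ i → Independent (Full F) (hat ∘ As i)) → Independent (Full F) rows
      rows-independent blocks-independent a _ a·rows≐0 t = begin
        a t                             ≡⟨ ≡.cong a (flatten-unflatten b N t) ⟨
        a (flatten b N (i , j))         ≈⟨ blocks-independent i (λ j → a (flatten b N (i , j))) _ block-relation j ⟩
        0#                              ∎
        where
        i : Fin b
        i = proj₁ (unflatten b N t)
        j : Fin (N i)
        j = proj₂ (unflatten b N t)
        block-relation : ∀ {i} → linComb (λ j → a (flatten b N (i , j))) (hat ∘ As i) ≐ 0v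
        block-relation {i} k = begin
          sum (λ j → a (flatten b N (i , j)) * hat (As i j) k)
            ≈⟨ sum-cong-≋ (λ j → *-congˡ (embed-diag i (hat (As i j)) k)) ⟨
          sum (λ j → a (flatten b N (i , j)) * row (i , j) (i , k))
            ≈⟨ sum-single i _ (λ i' i'≢i → sum-zero (λ j → trans (*-congˡ (embed-off (hat (As i' j)) k i'≢i)) (zeroʳ _))) ⟨
          sum (λ i' → sum (λ j → a (flatten b N (i' , j)) * row (i' , j) (i , k)))
            ≈⟨ sum-unflatten b N (λ p → a (flatten b N p) * row p (i , k)) ⟨
          sum (λ t → a (flatten b N (unflatten b N t)) * row (unflatten b N t) (i , k))
            ≡⟨ sum-cong-≗ (λ t → ≡.cong₂ (λ t' p → a t' * row (unflatten b N t) p)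
                                        (flatten-unflatten b N t) (≡.sym (unflatten-flatten b ns (i , k)))) ⟩
          linComb a rows (flatten b ns (i , k))
            ≈⟨ a·rows≐0 (flatten b ns (i , k)) ⟩
          0#                                                                      ∎

  flattenBasis : ∀ b {N : Fin b → ℕ} {P : Vec F (shape b N) → Set (c ⊔ ℓ)} {Q : (Fin (sumℕ b N) → Carrier) → Set (c ⊔ ℓ)}
                 {d} {v : Fin d → Vec F (shape b N)} → IsBasis F (Full F) P v →
                 (∀ i → Q (v i ∘ unflatten b N)) → (∀ {w} → Q w → ∃[ y ] (P y × (y ∘ unflatten b N) ≐ w)) → BasisOf Q
  flattenBasis b {N} {d = d} {v} B v∈Q Q⊆P = record
    { dim = d ; basis = λ i → v i ∘ unflatten b N
    ; basis-independent = λ a _ a·v≐0 → IsBasis⇒independent B a _ λ p →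
        trans (reflexive (≡.cong (linComb a v) (≡.sym (unflatten-flatten b N p)))) (a·v≐0 (flatten b N p))
    ; basis-in = v∈Q
    ; spans = λ Qw → let (y , Py , y≐w) = Q⊆P Qw ; inSpan a _ a·v≐y = IsBasis⇒spans B Py in
        inSpan a _ (λ t → trans (a·v≐y (unflatten b N t)) (y≐w t)) }

  module Theorem (b : ℕ) (ns : Fin b → ℕ) (𝓒 : Vec F (shape b ns) → Set (c ⊔ ℓ)) where
    open Coordinates b ns

    D : Vec F (shape b ns) → Set (c ⊔ ℓ)
    D = Orth F (Full F) {shape b ns} 𝓒

    module _ {N : Fin b → ℕ} (As : (i : Fin b) → Fin (N i) → Vec F (one F (ns i))) where

      Π-· : ∀ z i j → Π F As z (i , j) ≈ (λ k → z (i , k)) · hat (As i j)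
      Π-· z i j = reflexive (Σ≡sum (ns i) (λ k → z (i , k) * As i j (zero , k)))

      Π-linComb : ∀ {m} (a : Fin m → Carrier) (V : Fin m → X → Carrier) →
                  Π F As (linComb a V) ≐ linComb a (λ l → Π F As (V l))
      Π-linComb a V (i , j) = begin
        Π F As (linComb a V) (i , j)                                  ≈⟨ Π-· (linComb a V) i j ⟩
        linComb a (λ l k → V l (i , k)) · hat (As i j)                ≈⟨ linComb-· a (λ l k → V l (i , k)) (hat (As i j)) ⟩
        sum (λ l → a l * ((λ k → V l (i , k)) · hat (As i j)))        ≈⟨ sum-cong-≋ (λ l → *-congˡ (Π-· (V l) i j)) ⟨
        linComb a (λ l → Π F As (V l)) (i , j)                        ∎

      Π-sub : ∀ z z' → Π F As (λ p → z p - z' p) ≐ (λ q → Π F As z q - Π F As z' q)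
      Π-sub z z' (i , j) = trans (Π-· (λ p → z p - z' p) i j)
        (trans (·-sub (λ k → z (i , k)) (λ k → z' (i , k)) (hat (As i j))) (+-cong (sym (Π-· z i j)) (-‿cong (sym (Π-· z' i j)))))

    module Code {k} (x̃ : Fin k → X → Carrier) (x̃∈D : ∀ j → D (x̃ j)) (D⊆x̃ : ∀ {z} → D z → InSpan (Full F) x̃ z) where

      x : Fin k → Fin (sumℕ b ns) → Carrier
      x j = ♭ (x̃ j)

      span-x̃⊆D : ∀ {z} → InSpan (Full F) x̃ z → D z
      span-x̃⊆D {z} (inSpan a _ a·x̃≐z) = _ , λ y y∈𝓒 → begin
        dot F {shape b ns} z y                         ≈⟨ dot-♭ z y ⟩
        ♭ z · ♭ y                                      ≈⟨ sum-cong-≋ (λ t → *-congʳ (a·x̃≐z (unflatten b ns t))) ⟨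
        linComb a x · ♭ y                              ≈⟨ linComb-· a x (♭ y) ⟩
        sum (λ j → a j * (x j · ♭ y))                  ≈⟨ sum-zero (λ j → trans (*-congˡ (trans (sym (dot-♭ (x̃ j) y))
                                                            (proj₂ (x̃∈D j) y y∈𝓒))) (zeroʳ _)) ⟩
        0#                                             ∎

      projection-basis : ∀ {N : Fin b → ℕ} {As : (i : Fin b) → Fin (N i) → Vec F (one F (ns i))} {a} {v} →
                         IsBasis F (Full F) (Img F As 𝓒) {a} v → BasisOf (Projection (Rows.rows As) (InSpan (Full F) x))
      projection-basis {N} {As} B = flattenBasis b B
        (λ i → let (z , z∈D , Πz≋v) = IsBasis.inP B i in
               ♭ z , InSpan-♭ (D⊆x̃ z∈D) , λ t → trans (sym (Rows.Π-rows As z t)) (Πz≋v (unflatten b N t)))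
        λ { (z , inSpan a _ a·x≐z , z·w≐v) →
               Π F As (linComb a x̃) , (linComb a x̃ , span-x̃⊆D (inSpan a _ (λ _ → refl)) , λ _ → refl) , λ t → begin
                 Π F As (linComb a x̃) (unflatten b N t)     ≈⟨ Rows.Π-rows As (linComb a x̃) t ⟩
                 linComb a x · Rows.rows As t              ≈⟨ sum-cong-≋ (λ m → *-congʳ (a·x≐z m)) ⟩
                 z · Rows.rows As t                        ≈⟨ z·w≐v t ⟩
                 _                                         ∎ }
        where
        InSpan-♭ : ∀ {z} → InSpan (Full F) x̃ z → InSpan (Full F) x (♭ z)
        InSpan-♭ (inSpan a _ a·x̃≐z) = inSpan a _ (a·x̃≐z ∘ unflatten b ns)

      dual-projection-basis : ∀ {N : Fin b → ℕ} {As : (i : Fin b) → Fin (N i) → Vec F (one F (ns i))} {s} {v} →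
                              IsBasis F (Full F) (Img F As D) {s} v → BasisOf (Projection (Rows.rows As) (Orthogonal x))
      dual-projection-basis {N} {As} B = flattenBasis b B
        (λ i → let (z , (_ , z⊥D) , Πz≋v) = IsBasis.inP B i in
               ♭ z , (λ j → trans (sym (dot-♭ z (x̃ j))) (z⊥D (x̃ j) (x̃∈D j))) ,
               λ t → trans (sym (Rows.Π-rows As z t)) (Πz≋v (unflatten b N t)))
        λ { {w} (z , z⊥x , z·u≐w) →
               Π F As (z ∘ flatten b ns) , (z ∘ flatten b ns , ♯z⊥D z z⊥x , λ _ → refl) , λ t → begin
                 Π F As (z ∘ flatten b ns) (unflatten b N t)   ≈⟨ Rows.Π-rows As (z ∘ flatten b ns) t ⟩
                 ♭ (z ∘ flatten b ns) · Rows.rows As t         ≈⟨ sum-cong-≋ (λ m → *-congʳ (♭♯ z m)) ⟩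
                 z · Rows.rows As t                            ≈⟨ z·u≐w t ⟩
                 w t                                           ∎ }
        where
        ♭♯ : ∀ (z : Fin (sumℕ b ns) → Carrier) → ♭ (z ∘ flatten b ns) ≐ z
        ♭♯ z m = reflexive (≡.cong z (flatten-unflatten b ns m))
        ♯z⊥D : ∀ z → Orthogonal x z → Orth F (Full F) D (z ∘ flatten b ns)
        ♯z⊥D z z⊥x = _ , λ y y∈D → let inSpan a _ a·x̃≐y = D⊆x̃ y∈D in begin
          dot F {shape b ns} (z ∘ flatten b ns) y     ≈⟨ dot-♭ (z ∘ flatten b ns) y ⟩
          ♭ (z ∘ flatten b ns) · ♭ y                  ≈⟨ sum-cong-≋ (λ m → *-cong (♭♯ z m) (sym (a·x̃≐y (unflatten b ns m)))) ⟩
          z · linComb a x                             ≈⟨ ·-comm z (linComb a x) ⟩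
          linComb a x · z                             ≈⟨ linComb-· a x z ⟩
          sum (λ j → a j * (x j · z))                 ≈⟨ sum-zero (λ j → trans (*-congˡ (trans (·-comm (x j) z) (z⊥x j))) (zeroʳ _)) ⟩
          0#                                          ∎

    module _ (Ks : Fin b → Carrier → Set (c ⊔ ℓ)) (isK : ∀ i → IsSubfield F (Ks i)) where

      -- The rows of a basis of K^n make Π injective, so a basis of Π(D) lifts to a basis of D.
      module FullRows {N : Fin b → ℕ} {As : (i : Fin b) → Fin (N i) → Vec F (one F (ns i))}
                      (basis : ∀ i → IsBasis F (Ks i) (TupleFull F {b} {ns} Ks i) (As i)) where

        Π-injective : ∀ v → Π F As v ≐ 0v → v ≐ 0v
        Π-injective v Πv≐0 (i , k₀) = begin
          v (i , k₀)                                    ≈⟨ *-identityʳ _ ⟨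
          v (i , k₀) * 1#                               ≈⟨ *-congˡ (unit-diag k₀) ⟨
          v (i , k₀) * unit k₀ k₀                       ≈⟨ sum-single k₀ (λ k → v (i , k) * unit k₀ k)
                                                             (λ k k≢k₀ → trans (*-congˡ (unit-off (k≢k₀ ∘ ≡.sym))) (zeroʳ _)) ⟨
          vᵢ · unit k₀                                  ≈⟨ sum-cong-≋ (λ k → *-congˡ (a·As≐e (zero , k))) ⟨
          vᵢ · linComb a (hat ∘ As i)                   ≈⟨ ·-comm vᵢ _ ⟩
          linComb a (hat ∘ As i) · vᵢ                   ≈⟨ linComb-· a (hat ∘ As i) vᵢ ⟩
          sum (λ l → a l * (hat (As i l) · vᵢ))         ≈⟨ sum-zero (λ l → trans (*-congˡ (trans (·-comm _ vᵢ)
                                                             (trans (sym (Π-· As v i l)) (Πv≐0 (i , l))))) (zeroʳ _)) ⟩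
          0#                                            ∎
          where
          vᵢ : Fin (ns i) → Carrier
          vᵢ k = v (i , k)
          e∈Kⁿ : TupleFull F {b} {ns} Ks i (unhat (unit k₀))
          e∈Kⁿ (zero , k) = Spans.S-unit (Ks i) (isK i) k₀ k
          open InSpan (IsBasis⇒spans (basis i) e∈Kⁿ) renaming (coeffs to a; combines to a·As≐e)

        module _ {k} {y : Fin k → Vec F (shape b N)} (basis-y : IsBasis F (Full F) (Img F As 𝓒) y) where

          x̃ : Fin k → X → Carrier
          x̃ j = proj₁ (IsBasis.inP basis-y j)

          x̃∈D : ∀ j → D (x̃ j)
          x̃∈D j = proj₁ (proj₂ (IsBasis.inP basis-y j))

          D⊆x̃ : ∀ {z} → D z → InSpan (Full F) x̃ z
          D⊆x̃ {z} z∈D = inSpan a _ λ p →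
            sym (x∙y⁻¹≈ε⇒x≈y _ _ (Π-injective (λ p → z p - linComb a x̃ p) Π[z-a·x̃]≐0 p))
            where
            open InSpan (IsBasis⇒spans basis-y (z , z∈D , λ _ → refl)) renaming (coeffs to a; combines to a·y≐Πz)
            Π[z-a·x̃]≐0 : Π F As (λ p → z p - linComb a x̃ p) ≐ 0v
            Π[z-a·x̃]≐0 q = begin
              Π F As (λ p → z p - linComb a x̃ p) q               ≈⟨ Π-sub As z (linComb a x̃) q ⟩
              Π F As z q - Π F As (linComb a x̃) q                ≈⟨ +-congˡ (-‿cong (Π-linComb As a x̃ q)) ⟩
              Π F As z q - linComb a (λ l → Π F As (x̃ l)) q      ≈⟨ +-congˡ (-‿cong (linComb-congʳ a (λ l → proj₂ (proj₂ (IsBasis.inP basis-y l))) q)) ⟩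
              Π F As z q - linComb a y q                         ≈⟨ +-congˡ (-‿cong (a·y≐Πz q)) ⟩
              Π F As z q - Π F As z q                            ≈⟨ -‿inverseʳ _ ⟩
              0#                                                 ∎

          ♭x̃-independent : Independent (Full F) (♭ ∘ x̃)
          ♭x̃-independent a _ a·x≐0 = IsBasis⇒independent basis-y a _ λ q → begin
            linComb a y q                              ≈⟨ linComb-congʳ a (λ l → proj₂ (proj₂ (IsBasis.inP basis-y l))) q ⟨
            linComb a (λ l → Π F As (x̃ l)) q           ≈⟨ Π-linComb As a x̃ q ⟨
            Π F As (linComb a x̃) q                     ≈⟨ Π-· As (linComb a x̃) (proj₁ q) (proj₂ q) ⟩
            (λ k → linComb a x̃ (proj₁ q , k)) · hat (As (proj₁ q) (proj₂ q))
                                                       ≈⟨ sum-zero (λ k → trans (*-congʳ (a·x̃≐0 (proj₁ q , k))) (zeroˡ _)) ⟩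
            0#                                         ∎
            where
            a·x̃≐0 : linComb a x̃ ≐ 0v
            a·x̃≐0 p = trans (reflexive (≡.cong (linComb a x̃) (≡.sym (unflatten-flatten b ns p)))) (a·x≐0 (flatten b ns p))

      dimension-identity : ∀ {𝓛 : Tuple F b ns} {a r k s} →
        RhoIs F Ks 𝓒 (TupleOrth F Ks 𝓛) a → RkIs F Ks 𝓛 r → RhoIs F Ks 𝓒 (TupleFull F Ks) k → RhoIs F Ks D 𝓛 s →
        s ℕ.+ k ≡ a ℕ.+ r
      dimension-identity {a = a} {r} (Na , Asa , basisA , _ , basis-yA) (_ , dimR , ΣNr≡r) (_ , _ , basisK , _ , basis-yk)
                                     (Ns , Ass , basisS , _ , basis-yS) =
        ≡.trans (projection-dimensions (♭x̃-independent basis-yk)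
                                       (rows-independent {Ns} Ass basisS) (rows-independent {Na} Asa basisA) q+r≡n w⊥u
                                       (projection-basis {As = Asa} basis-yA) (dual-projection-basis {As = Ass} basis-yS))
                (≡.cong (a ℕ.+_) ΣNs≡r)
        where
        open FullRows basisK
        open Code (x̃ basis-yk) (x̃∈D basis-yk) (D⊆x̃ basis-yk)
        module Bl (i : Fin b) = Block (isK i) (basisS i) (basisA i)

        rows-independent : ∀ {N} (As : (i : Fin b) → Fin (N i) → Vec F (one F (ns i))) {L : Tuple F b ns} →
                           (∀ i → IsBasis F (Ks i) (L i) (As i)) → Independent (Full F) (Rows.rows As)
        rows-independent As basis = Rows.rows-independent As (λ i → Bl.hat-independentᶠ i (basis i))

        ΣNs≡r : sumℕ b Ns ≡ r
        ΣNs≡r = ≡.trans (sumℕ-cong b (λ i → ≡.sym (Bl.rank-unique i (dimR i)))) ΣNr≡r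

        q+r≡n : sumℕ b Na ℕ.+ sumℕ b Ns ≡ sumℕ b ns
        q+r≡n = ≡.trans (≡.sym (sumℕ-+ b Na Ns)) (sumℕ-cong b Bl.complementary)

        rows-orthogonal : ∀ p p' → dot F {shape b ns} (Rows.row Asa p) (Rows.row Ass p') ≈ 0#
        rows-orthogonal (i , j) (i' , j') with i Fin.≟ i'
        ... | no i≢i' = dot-embed-off _ _ i≢i'
        ... | yes ≡.refl = trans (dot-embed-diag i _ _) (trans (sym (Bl.dot-one i (Asa i j) (Ass i j')))
                                  (proj₂ (IsBasis.inP (basisA i) j) (Ass i j') (IsBasis.inP (basisS i) j')))

        w⊥u : ∀ t t' → Rows.rows Asa t · Rows.rows Ass t' ≈ 0#
        w⊥u t t' = trans (sym (dot-♭ (Rows.row Asa (unflatten b Na t)) (Rows.row Ass (unflatten b Ns t'))))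
                         (rows-orthogonal (unflatten b Na t) (unflatten b Ns t'))

open import Data.Nat using (ℕ; _+_; _∸_; _≤_)
open import Data.Fin using (Fin)
open import Relation.Binary.PropositionalEquality using (_≡_)

theorem37 : {c ℓ : Level} (F : Field c ℓ) → Finite F →
    (b : ℕ) → 1 ≤ b → (ns : Fin b → ℕ) → (∀ i → 1 ≤ ns i) →
    (Ks : Fin b → Field.Carrier F → Set (c ⊔ ℓ)) →
    (∀ i → IsSubfield F (Ks i)) →
    (𝓒 : Vec F (shape b ns) → Set (c ⊔ ℓ)) → IsSubspace F (Full F) 𝓒 →
    (𝓛 : Tuple F b ns) → InP F b ns Ks 𝓛 →
    (a r k s : ℕ) →
    RhoIs F Ks 𝓒 (TupleOrth F Ks 𝓛) a →
    RkIs F Ks 𝓛 r →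
    RhoIs F Ks 𝓒 (TupleFull F Ks) k →
    RhoIs F Ks (Orth F (Full F) 𝓒) 𝓛 s →
    s ≡ a + r ∸ k
theorem37 F fin b _ ns _ Ks isK 𝓒 _ 𝓛 _ a r k s ρ-𝓛⊥ rk-𝓛 ρ-all ρ-dual =
  ≡.trans (≡.sym (ℕₚ.m+n∸n≡m s k)) (≡.cong (_∸ k) (dimension-identity Ks isK ρ-𝓛⊥ rk-𝓛 ρ-all ρ-dual))
  where open SumRank.Theorem F fin b ns 𝓒
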